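{- Let $n\ge 1$ (of either parity) and let $T$ be the complex permutation representation of $S_n$ arising from the action of $S_n$ on the set of odd-sized subsets of $\{1,\dots,n\}$, given by $\pi\cdot A=\pi(A)$. For $\pi,\sigma\in S_n$, if $T(\pi)$ and $T(\sigma)$ are similar matrices, then $\pi$ and $\sigma$ are conjugate in $S_n$.
   Context: The permutation representation associated with an action of a group on a finite set $X$ sends a group element to the $|X|\times|X|$ permutation matrix of its action on $X$. -}

module Defs where

open import Level using (Level)
open import Data.Nat using (ℕ; zero; suc; _%_)
open import Data.Bool using (Bool; true; false)
open import Data.Fin using (Fin)
open import Data.Fin.Subset using (Subset; ∣_∣)
open import Data.Fin.Permutation using (Permutation′; _⟨$⟩ʳ_; _⟨$⟩ˡ_)
open import Data.Vec using (Vec; []; _∷_; tabulate; lookup)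
open import Data.Vec.Properties using (≡-dec)
open import Data.List using (List; []; _∷_; _++_; map; foldr)
open import Data.Product using (Σ; Σ-syntax; ∃; ∃-syntax; _×_; _,_; proj₁)
open import Relation.Nullary using (¬_; yes; no)
open import Relation.Binary.PropositionalEquality using (_≡_)
open import Algebra.Bundles using (CommutativeRing)
import Data.Bool.Properties as BoolP
import Data.Nat.Properties as NatP

module _ {c ℓ : Level} (K : CommutativeRing c ℓ) where
  open CommutativeRing K

  IsField : Set (c Level.⊔ ℓ)
  IsField = (¬ (1# ≈ 0#)) × (∀ x → ¬ (x ≈ 0#) → ∃[ y ] (x * y ≈ 1#))

  ℕ→K : ℕ → Carrier
  ℕ→K zero    = 0#
  ℕ→K (suc k) = 1# + ℕ→K k

  CharZero : Set ℓ
  CharZero = ∀ k → ℕ→K (suc k) ≈ 0# → Data.Empty.⊥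
    where import Data.Empty

IsOdd : ℕ → Set
IsOdd k = k % 2 ≡ 1

OddSubset : ℕ → Set
OddSubset n = Σ (Subset n) (λ A → IsOdd ∣ A ∣)

allSubsets : ∀ n → List (Subset n)
allSubsets zero    = [] ∷ []
allSubsets (suc n) = map (true ∷_) (allSubsets n) ++ map (false ∷_) (allSubsets n)

-- enumeration of all odd-sized subsets (each exactly once)
oddSubsets : ∀ n → List (OddSubset n)
oddSubsets n = go (allSubsets n)
  where
  go : List (Subset n) → List (OddSubset n)
  go []       = []
  go (A ∷ As) with ∣ A ∣ % 2 NatP.≟ 1
  ... | yes p = (A , p) ∷ go As
  ... | no _  = go As

-- action of a permutation on subsets: π · A = π(A), i.e. j ∈ π(A) iff π⁻¹ j ∈ A
act : ∀ {n} → Permutation′ n → Subset n → Subset n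
act π A = tabulate (λ j → lookup A (π ⟨$⟩ˡ j))

Conjugate : ∀ {n} → Permutation′ n → Permutation′ n → Set
Conjugate {n} π σ =
  ∃[ τ ] (∀ (i : Fin n) → σ ⟨$⟩ʳ i ≡ τ ⟨$⟩ʳ (π ⟨$⟩ʳ (τ ⟨$⟩ˡ i)))

module Matrices {c ℓ : Level} (K : CommutativeRing c ℓ) (n : ℕ) where
  open CommutativeRing K

  Mat : Set c
  Mat = OddSubset n → OddSubset n → Carrier

  _≈ᴹ_ : Mat → Mat → Set ℓ
  M ≈ᴹ N = ∀ A B → M A B ≈ N A B

  _*ᴹ_ : Mat → Mat → Mat
  (M *ᴹ N) A C = foldr (λ B acc → M A B * N B C + acc) 0# (oddSubsets n)

  δ : Subset n → Subset n → Carrier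
  δ A B with ≡-dec BoolP._≟_ A B
  ... | yes _ = 1#
  ... | no _  = 0#

  Iᴹ : Mat
  Iᴹ A B = δ (proj₁ A) (proj₁ B)

  -- permutation matrix: T(π) e_A = e_{π(A)}, i.e. T(π)_{B,A} = [B = π(A)]
  T : Permutation′ n → Mat
  T π B A = δ (proj₁ B) (act π (proj₁ A))

  Similar : Mat → Mat → Set (c Level.⊔ ℓ)
  Similar M N = ∃[ P ] ∃[ Q ]
    (((P *ᴹ Q) ≈ᴹ Iᴹ) × ((Q *ᴹ P) ≈ᴹ Iᴹ) × ((P *ᴹ M) ≈ᴹ (N *ᴹ P)))

-- Taking traces, similarity of T(π) and T(σ) gives, for every k, the same number of odd-sized
-- subsets fixed by π ^ k and by σ ^ k (characteristic zero lets us compare these counts in ℕ).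
-- A subset fixed by a permutation ρ is a union of cycles of ρ, so this number is 2 ^ (c - 1) if ρ
-- has c cycles, one of them of odd length, and 0 otherwise. Under the k-th power an l-cycle splits
-- into gcd l k cycles of length l / gcd l k. So for the cycle type L of π the counts tell, for each k,
-- whether some l / gcd l k is odd and, if so, the value of Σ_{l ∈ L} gcd l k. For the least e for
-- which some l / gcd l (2 ^ e) is odd, 2 ^ e divides every cycle length and the data is available
-- at every k = 2 ^ e * m; this yields Σ_{l ∈ L} gcd (l / 2 ^ e) m for all m. Since
-- Σ_{d ∣ g} φ d = g, these sums determine, by induction on d, how many l / 2 ^ e are multiples of d,
-- hence the multiset L itself. Permutations with the same cycle type are conjugate.

module Submission where

open import Defs
open import Level using (Level)
open import Algebra.Bundles using (CommutativeRing)
open import Relation.Binary.Bundles using (Setoid)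
import Relation.Binary.Reasoning.Setoid
open import Data.Nat using (ℕ; zero; suc; _%_; _≥_)
import Data.Nat.Properties as ℕ
open import Data.Bool using (Bool; true; false)
import Data.Bool.Properties as Bool
open import Data.Fin using (Fin; zero; suc; toℕ)
import Data.Fin.Properties as Fin
open import Data.Fin.Subset using (Subset; ∣_∣)
open import Data.Fin.Permutation using (Permutation′; _⟨$⟩ʳ_; _⟨$⟩ˡ_; _∘ₚ_; flip; inverseˡ; inverseʳ; permutation)
import Data.Fin.Permutation as Perm
open import Data.Vec using ([]; _∷_; tabulate; lookup)
import Data.Vec.Properties as Vec
open import Data.List using (List; []; _∷_; _++_; map; filter; filterᵇ; length; foldr; concatMap; applyUpTo; allFin; replicate)
import Data.List as List
open import Data.List.Properties
  using ( filter-accept; filter-reject; filter-++; filter-≐; length-map; length-++; length-applyUpTo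
        ; map-∘; map-++; map-cong; map-cong-local; map-applyUpTo; map-concatMap; concatMap-map; ∷-injectiveʳ)
open import Data.List.Membership.Propositional using (_∈_; _∉_; find; lose)
open import Data.List.Membership.Propositional.Properties
  using ( ∈-map⁺; ∈-map⁻; ∈-++⁺ˡ; ∈-++⁺ʳ; ∈-++⁻; ∈-filter⁺; ∈-filter⁻; ∈-concatMap⁺; ∈-concatMap⁻
        ; ∈-applyUpTo⁺; ∈-applyUpTo⁻; ∈-allFin; ∈-∃++)
open import Data.List.Membership.Propositional.Properties.WithK using (unique∧set⇒bag)
open import Data.List.Relation.Unary.Any using (Any; here; there; any?)
import Data.List.Relation.Unary.Any as Any
import Data.List.Relation.Unary.Any.Properties as Any
open import Data.List.Relation.Unary.All as All using (All; []; _∷_)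
open import Data.List.Relation.Unary.AllPairs using ([]; _∷_)
open import Data.List.Relation.Unary.Unique.Propositional using (Unique)
import Data.List.Relation.Unary.Unique.Propositional.Properties as Unique
open import Data.List.Relation.Binary.BagAndSetEquality using (∼bag⇒↭)
open import Data.List.Relation.Binary.Permutation.Propositional
  using (_↭_; ↭-refl; ↭-sym; ↭-trans; prep; ↭⇒↭ₛ; module PermutationReasoning)
import Data.List.Relation.Binary.Permutation.Propositional as ↭
import Data.List.Relation.Binary.Permutation.Propositional.Properties as ↭
import Data.List.Relation.Binary.Permutation.Setoid.Properties as ↭ₛ
open import Data.Product using (Σ; ∃-syntax; _,_; proj₁; proj₂; _×_)
open import Data.Sum using (inj₁; inj₂)
open import Data.Empty using (⊥; ⊥-elim)
open import Function.Base using (_∘_)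
open import Function.Bundles using (_⇔_; mk⇔; Equivalence)
open import Relation.Nullary using (¬_; ¬?; yes; no; Dec; does)
open import Relation.Nullary.Decidable using (dec-true; dec-false; does-⇔)
open import Relation.Nullary.Decidable.Core using (T?)
open import Relation.Unary using (Decidable)
open import Relation.Binary.Definitions using (tri<; tri≈; tri>)
open import Relation.Binary.PropositionalEquality as ≡ using (_≡_; _≢_; module ≡-Reasoning)
import Algebra.Properties.CommutativeMonoid.Sum ℕ.+-0-commutativeMonoid as FinSum

allSubsets-complete : ∀ n (A : Subset n) → A ∈ allSubsets n
allSubsets-complete zero    []          = here ≡.refl
allSubsets-complete (suc n) (true ∷ A)  = ∈-++⁺ˡ (∈-map⁺ (true ∷_) (allSubsets-complete n A))
allSubsets-complete (suc n) (false ∷ A) = ∈-++⁺ʳ _ (∈-map⁺ (false ∷_) (allSubsets-complete n A))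

allSubsets-unique : ∀ n → Unique (allSubsets n)
allSubsets-unique zero    = [] ∷ []
allSubsets-unique (suc n) =
  Unique.++⁺ (Unique.map⁺ Vec.∷-injectiveʳ (allSubsets-unique n)) (Unique.map⁺ Vec.∷-injectiveʳ (allSubsets-unique n)) disjoint
  where
  disjoint : ∀ {v} → ¬ (v ∈ map (true ∷_) (allSubsets n) × v ∈ map (false ∷_) (allSubsets n))
  disjoint (v∈ , v∈′) with ∈-map⁻ (true ∷_) v∈ | ∈-map⁻ (false ∷_) v∈′
  ... | _ , _ , ≡.refl | _ , _ , ()

odd? : Decidable IsOdd
odd? k = k % 2 ℕ.≟ 1

oddSize? : ∀ {n} (A : Subset n) → Dec (IsOdd ∣ A ∣)
oddSize? A = odd? ∣ A ∣

private
  -- `oddSubsets` filters through a local function that cannot be named; unification recovers it.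
  oddFilter : ∀ n → Σ (List (Subset n) → List (OddSubset n)) λ go → go (allSubsets n) ≡ oddSubsets n
  oddFilter n = go , unfold
    where
    go : List (Subset n) → List (OddSubset n)
    go = _
    unfold : go (allSubsets n) ≡ oddSubsets n
    unfold with allSubsets n
    ... | _ = ≡.refl

  proj₁-oddFilter : ∀ n xs → map proj₁ (proj₁ (oddFilter n) xs) ≡ filter oddSize? xs
  proj₁-oddFilter n []       = ≡.refl
  proj₁-oddFilter n (A ∷ As) with odd? ∣ A ∣
  ... | yes odd = ≡.trans (≡.cong (A ∷_) (proj₁-oddFilter n As))
                          (≡.sym (filter-accept oddSize? {x = A} {xs = As} odd))
  ... | no ¬odd = ≡.trans (proj₁-oddFilter n As) (≡.sym (filter-reject oddSize? {x = A} {xs = As} ¬odd))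

proj₁-oddSubsets : ∀ n → map proj₁ (oddSubsets n) ≡ filter oddSize? (allSubsets n)
proj₁-oddSubsets n = ≡.subst (λ X → map proj₁ X ≡ filter oddSize? (allSubsets n))
                             (proj₂ (oddFilter n)) (proj₁-oddFilter n (allSubsets n))

oddSubsets-unique : ∀ n → Unique (map proj₁ (oddSubsets n))
oddSubsets-unique n rewrite proj₁-oddSubsets n = Unique.filter⁺ oddSize? (allSubsets-unique n)

oddSubsets-complete : ∀ n (X : OddSubset n) → X ∈ oddSubsets n
oddSubsets-complete n (A , odd) with ∈-map⁻ proj₁ A∈
  where
  A∈ : A ∈ map proj₁ (oddSubsets n)
  A∈ = ≡.subst (A ∈_) (≡.sym (proj₁-oddSubsets n)) (∈-filter⁺ oddSize? (allSubsets-complete n A) odd)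
... | (A , odd′) , X∈ , ≡.refl = ≡.subst (λ p → (A , p) ∈ oddSubsets n) (ℕ.≡-irrelevant odd′ odd) X∈

boolToℕ : Bool → ℕ
boolToℕ true  = 1
boolToℕ false = 0

∣∣≡sum : ∀ {n} (A : Subset n) → ∣ A ∣ ≡ FinSum.sum (λ i → boolToℕ (lookup A i))
∣∣≡sum []          = ≡.refl
∣∣≡sum (true ∷ A)  = ≡.cong suc (∣∣≡sum A)
∣∣≡sum (false ∷ A) = ∣∣≡sum A

∣act∣ : ∀ {n} (ρ : Permutation′ n) (A : Subset n) → ∣ act ρ A ∣ ≡ ∣ A ∣
∣act∣ ρ A = begin
  ∣ act ρ A ∣
    ≡⟨ ∣∣≡sum (act ρ A) ⟩
  FinSum.sum (λ i → boolToℕ (lookup (act ρ A) i))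
    ≡⟨ FinSum.sum-cong-≗ (λ i → ≡.cong boolToℕ (Vec.lookup∘tabulate (λ j → lookup A (ρ ⟨$⟩ˡ j)) i)) ⟩
  FinSum.sum (λ i → boolToℕ (lookup A (ρ ⟨$⟩ˡ i)))
    ≡⟨ FinSum.sum-permute (λ i → boolToℕ (lookup A i)) (flip ρ) ⟨
  FinSum.sum (λ i → boolToℕ (lookup A i))
    ≡⟨ ∣∣≡sum A ⟨
  ∣ A ∣ ∎
  where open ≡-Reasoning

act-∘ₚ : ∀ {n} (π ρ : Permutation′ n) A → act π (act ρ A) ≡ act (ρ ∘ₚ π) A
act-∘ₚ π ρ A = Vec.tabulate-cong (λ j → Vec.lookup∘tabulate (λ i → lookup A (ρ ⟨$⟩ˡ i)) (π ⟨$⟩ˡ j))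

act-id : ∀ {n} (A : Subset n) → act Perm.id A ≡ A
act-id A = Vec.tabulate∘lookup A

infixr 8 _^ₚ_

_^ₚ_ : ∀ {n} → Permutation′ n → ℕ → Permutation′ n
ρ ^ₚ zero  = Perm.id
ρ ^ₚ suc k = (ρ ^ₚ k) ∘ₚ ρ

fixed? : ∀ {n} (ρ : Permutation′ n) (A : Subset n) → Dec (A ≡ act ρ A)
fixed? ρ A = Vec.≡-dec Bool._≟_ A (act ρ A)

fixedOddCount : ∀ {n} → Permutation′ n → ℕ
fixedOddCount {n} ρ = length (filter (λ X → fixed? ρ (proj₁ X)) (oddSubsets n))

module ListSum {c ℓ : Level} (K : CommutativeRing c ℓ) where
  open CommutativeRing K
  open import Algebra.Properties.CommutativeSemigroup +-commutativeSemigroup using (interchange)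

  ∑ : ∀ {X : Set} → List X → (X → Carrier) → Carrier
  ∑ L f = foldr (λ x acc → f x + acc) 0# L

  ∑-cong : ∀ {X : Set} (L : List X) {f g : X → Carrier} → (∀ x → f x ≈ g x) → ∑ L f ≈ ∑ L g
  ∑-cong []      e = refl
  ∑-cong (x ∷ L) e = +-cong (e x) (∑-cong L e)

  ∑-0 : ∀ {X : Set} (L : List X) → ∑ L (λ _ → 0#) ≈ 0#
  ∑-0 []      = refl
  ∑-0 (x ∷ L) = trans (+-identityˡ _) (∑-0 L)

  ∑-+ : ∀ {X : Set} (L : List X) (f g : X → Carrier) → ∑ L (λ x → f x + g x) ≈ ∑ L f + ∑ L g
  ∑-+ []      f g = sym (+-identityˡ 0#)
  ∑-+ (x ∷ L) f g = trans (+-congˡ (∑-+ L f g)) (interchange (f x) (g x) (∑ L f) (∑ L g))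

  ∑-*ˡ : ∀ {X : Set} (L : List X) a (f : X → Carrier) → a * ∑ L f ≈ ∑ L (λ x → a * f x)
  ∑-*ˡ []      a f = zeroʳ a
  ∑-*ˡ (x ∷ L) a f = trans (distribˡ a (f x) (∑ L f)) (+-congˡ (∑-*ˡ L a f))

  ∑-*ʳ : ∀ {X : Set} (L : List X) a (f : X → Carrier) → ∑ L f * a ≈ ∑ L (λ x → f x * a)
  ∑-*ʳ []      a f = zeroˡ a
  ∑-*ʳ (x ∷ L) a f = trans (distribʳ a (f x) (∑ L f)) (+-congˡ (∑-*ʳ L a f))

  ∑-comm : ∀ {X Y : Set} (L : List X) (L′ : List Y) (h : X → Y → Carrier) →
           ∑ L (λ x → ∑ L′ (h x)) ≈ ∑ L′ (λ y → ∑ L (λ x → h x y))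
  ∑-comm []      L′ h = sym (∑-0 L′)
  ∑-comm (x ∷ L) L′ h = trans (+-congˡ (∑-comm L L′ h)) (sym (∑-+ L′ (h x) (λ y → ∑ L (λ x → h x y))))

module MatrixAlgebra {c ℓ : Level} (K : CommutativeRing c ℓ) (n : ℕ) where
  open CommutativeRing K
  open Matrices K n
  open ListSum K
  module ≈-Reasoning = Relation.Binary.Reasoning.Setoid setoid

  Odd : List (OddSubset n)
  Odd = oddSubsets n

  ≈ᴹ-setoid : Setoid c ℓ
  ≈ᴹ-setoid = record
    { Carrier       = Mat
    ; _≈_           = _≈ᴹ_
    ; isEquivalence = record
      { refl  = λ A B → refl
      ; sym   = λ e A B → sym (e A B)
      ; trans = λ e e′ A B → trans (e A B) (e′ A B)
      }
    }

  module ≈ᴹ-Reasoning = Relation.Binary.Reasoning.Setoid ≈ᴹ-setoid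
  open Setoid ≈ᴹ-setoid using () renaming (refl to ≈ᴹ-refl; sym to ≈ᴹ-sym)

  *ᴹ-cong : ∀ {M M′ N N′} → M ≈ᴹ M′ → N ≈ᴹ N′ → (M *ᴹ N) ≈ᴹ (M′ *ᴹ N′)
  *ᴹ-cong eM eN A C = ∑-cong Odd (λ B → *-cong (eM A B) (eN B C))

  *ᴹ-assoc : ∀ M N P → ((M *ᴹ N) *ᴹ P) ≈ᴹ (M *ᴹ (N *ᴹ P))
  *ᴹ-assoc M N P A D = begin
    ∑ Odd (λ C → ∑ Odd (λ B → M A B * N B C) * P C D)
      ≈⟨ ∑-cong Odd (λ C → ∑-*ʳ Odd (P C D) (λ B → M A B * N B C)) ⟩
    ∑ Odd (λ C → ∑ Odd (λ B → (M A B * N B C) * P C D))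
      ≈⟨ ∑-comm Odd Odd (λ C B → (M A B * N B C) * P C D) ⟩
    ∑ Odd (λ B → ∑ Odd (λ C → (M A B * N B C) * P C D))
      ≈⟨ ∑-cong Odd (λ B → ∑-cong Odd (λ C → *-assoc (M A B) (N B C) (P C D))) ⟩
    ∑ Odd (λ B → ∑ Odd (λ C → M A B * (N B C * P C D)))
      ≈⟨ ∑-cong Odd (λ B → ∑-*ˡ Odd (M A B) (λ C → N B C * P C D)) ⟨
    ∑ Odd (λ B → M A B * ∑ Odd (λ C → N B C * P C D)) ∎
    where open ≈-Reasoning

  δ-≡ : ∀ {A B : Subset n} → A ≡ B → δ A B ≈ 1#
  δ-≡ {A} {B} A≡B with Vec.≡-dec Bool._≟_ A B
  ... | yes _  = refl
  ... | no A≢B = ⊥-elim (A≢B A≡B)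

  δ-≢ : ∀ {A B : Subset n} → A ≢ B → δ A B ≈ 0#
  δ-≢ {A} {B} A≢B with Vec.≡-dec Bool._≟_ A B
  ... | yes A≡B = ⊥-elim (A≢B A≡B)
  ... | no _    = refl

  δ-sym : ∀ (A B : Subset n) → δ A B ≈ δ B A
  δ-sym A B with Vec.≡-dec Bool._≟_ A B
  ... | yes A≡B = sym (δ-≡ (≡.sym A≡B))
  ... | no A≢B  = sym (δ-≢ (λ B≡A → A≢B (≡.sym B≡A)))

  ∑δ-∉ : ∀ (L : List (OddSubset n)) (A : Subset n) (g : OddSubset n → Carrier) →
         A ∉ map proj₁ L → ∑ L (λ B → δ A (proj₁ B) * g B) ≈ 0#
  ∑δ-∉ []      A g _  = refl
  ∑δ-∉ (B ∷ L) A g A∉ = begin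
    δ A (proj₁ B) * g B + ∑ L (λ B → δ A (proj₁ B) * g B)
      ≈⟨ +-cong (*-congʳ (δ-≢ (λ A≡B → A∉ (here A≡B)))) (∑δ-∉ L A g (λ A∈ → A∉ (there A∈))) ⟩
    0# * g B + 0#  ≈⟨ +-identityʳ _ ⟩
    0# * g B       ≈⟨ zeroˡ _ ⟩
    0#             ∎
    where open ≈-Reasoning

  ∑δ : ∀ (L : List (OddSubset n)) (X : OddSubset n) (g : OddSubset n → Carrier) →
       Unique (map proj₁ L) → X ∈ L → ∑ L (λ B → δ (proj₁ X) (proj₁ B) * g B) ≈ g X
  ∑δ (B ∷ L) X g (B∉ ∷ u) (here ≡.refl) = begin
    δ (proj₁ B) (proj₁ B) * g B + ∑ L (λ B′ → δ (proj₁ B) (proj₁ B′) * g B′)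
      ≈⟨ +-cong (*-congʳ (δ-≡ {proj₁ B} ≡.refl)) (∑δ-∉ L (proj₁ B) g (λ B∈ → All.lookup B∉ B∈ ≡.refl)) ⟩
    1# * g B + 0#  ≈⟨ +-identityʳ _ ⟩
    1# * g B       ≈⟨ *-identityˡ _ ⟩
    g B            ∎
    where open ≈-Reasoning
  ∑δ (B ∷ L) X g (B∉ ∷ u) (there X∈) = begin
    δ (proj₁ X) (proj₁ B) * g B + ∑ L (λ B′ → δ (proj₁ X) (proj₁ B′) * g B′)
      ≈⟨ +-cong (*-congʳ (δ-≢ (λ X≡B → All.lookup B∉ (∈-map⁺ proj₁ X∈) (≡.sym X≡B)))) (∑δ L X g u X∈) ⟩
    0# * g B + g X  ≈⟨ +-congʳ (zeroˡ _) ⟩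
    0# + g X        ≈⟨ +-identityˡ _ ⟩
    g X             ∎
    where open ≈-Reasoning

  ∑δ-Odd : ∀ (X : OddSubset n) (g : OddSubset n → Carrier) → ∑ Odd (λ B → δ (proj₁ X) (proj₁ B) * g B) ≈ g X
  ∑δ-Odd X g = ∑δ Odd X g (oddSubsets-unique n) (oddSubsets-complete n X)

  ∑δ-Oddʳ : ∀ (X : OddSubset n) (g : OddSubset n → Carrier) → ∑ Odd (λ B → g B * δ (proj₁ B) (proj₁ X)) ≈ g X
  ∑δ-Oddʳ X g = trans (∑-cong Odd (λ B → trans (*-comm _ _) (*-congʳ (δ-sym (proj₁ B) (proj₁ X))))) (∑δ-Odd X g)

  *ᴹ-identityˡ : ∀ M → (Iᴹ *ᴹ M) ≈ᴹ M
  *ᴹ-identityˡ M A C = ∑δ-Odd A (λ B → M B C)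

  *ᴹ-identityʳ : ∀ M → (M *ᴹ Iᴹ) ≈ᴹ M
  *ᴹ-identityʳ M A C = ∑δ-Oddʳ C (λ B → M A B)

  tr : Mat → Carrier
  tr M = ∑ Odd (λ A → M A A)

  tr-cong : ∀ {M N} → M ≈ᴹ N → tr M ≈ tr N
  tr-cong e = ∑-cong Odd (λ A → e A A)

  tr-*ᴹ-comm : ∀ M N → tr (M *ᴹ N) ≈ tr (N *ᴹ M)
  tr-*ᴹ-comm M N = trans (∑-comm Odd Odd (λ A B → M A B * N B A))
                        (∑-cong Odd (λ B → ∑-cong Odd (λ A → *-comm (M A B) (N B A))))

  actOdd : Permutation′ n → OddSubset n → OddSubset n
  actOdd ρ (A , odd) = act ρ A , ≡.trans (≡.cong (_% 2) (∣act∣ ρ A)) odd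

  T-∘ₚ : ∀ (π ρ : Permutation′ n) → (T π *ᴹ T ρ) ≈ᴹ T (ρ ∘ₚ π)
  T-∘ₚ π ρ B A = trans (∑δ-Oddʳ (actOdd ρ A) (λ C → δ (proj₁ B) (act π (proj₁ C))))
                       (reflexive (≡.cong (δ (proj₁ B)) (act-∘ₚ π ρ (proj₁ A))))

  T-id : T Perm.id ≈ᴹ Iᴹ
  T-id B A = reflexive (≡.cong (δ (proj₁ B)) (act-id (proj₁ A)))

  T-^ₚ-intertwined : ∀ {P π σ} → (P *ᴹ T π) ≈ᴹ (T σ *ᴹ P) → ∀ k → (P *ᴹ T (π ^ₚ k)) ≈ᴹ (T (σ ^ₚ k) *ᴹ P)
  T-^ₚ-intertwined {P} PT zero = begin
    P *ᴹ T Perm.id   ≈⟨ *ᴹ-cong (≈ᴹ-refl {P}) T-id ⟩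
    P *ᴹ Iᴹ          ≈⟨ *ᴹ-identityʳ P ⟩
    P                ≈⟨ *ᴹ-identityˡ P ⟨
    Iᴹ *ᴹ P          ≈⟨ *ᴹ-cong T-id (≈ᴹ-refl {P}) ⟨
    T Perm.id *ᴹ P   ∎
    where open ≈ᴹ-Reasoning
  T-^ₚ-intertwined {P} {π} {σ} PT (suc k) = begin
    P *ᴹ T (π ^ₚ suc k)              ≈⟨ *ᴹ-cong (≈ᴹ-refl {P}) (T-∘ₚ π (π ^ₚ k)) ⟨
    P *ᴹ (T π *ᴹ T (π ^ₚ k))         ≈⟨ *ᴹ-assoc P (T π) (T (π ^ₚ k)) ⟨
    (P *ᴹ T π) *ᴹ T (π ^ₚ k)         ≈⟨ *ᴹ-cong PT (≈ᴹ-refl {T (π ^ₚ k)}) ⟩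
    (T σ *ᴹ P) *ᴹ T (π ^ₚ k)         ≈⟨ *ᴹ-assoc (T σ) P (T (π ^ₚ k)) ⟩
    T σ *ᴹ (P *ᴹ T (π ^ₚ k))         ≈⟨ *ᴹ-cong (≈ᴹ-refl {T σ}) (T-^ₚ-intertwined PT k) ⟩
    T σ *ᴹ (T (σ ^ₚ k) *ᴹ P)         ≈⟨ *ᴹ-assoc (T σ) (T (σ ^ₚ k)) P ⟨
    (T σ *ᴹ T (σ ^ₚ k)) *ᴹ P         ≈⟨ *ᴹ-cong (T-∘ₚ σ (σ ^ₚ k)) (≈ᴹ-refl {P}) ⟩
    T (σ ^ₚ suc k) *ᴹ P              ∎
    where open ≈ᴹ-Reasoning

  similar-T-^ₚ : ∀ {π σ} → Similar (T π) (T σ) → ∀ k → Similar (T (π ^ₚ k)) (T (σ ^ₚ k))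
  similar-T-^ₚ (P , Q , PQ , QP , PT) k = P , Q , PQ , QP , T-^ₚ-intertwined PT k

  similar⇒tr≈ : ∀ {M N} → Similar M N → tr M ≈ tr N
  similar⇒tr≈ {M} {N} (P , Q , PQ , QP , PM) = begin
    tr M                 ≈⟨ tr-cong (*ᴹ-identityˡ M) ⟨
    tr (Iᴹ *ᴹ M)         ≈⟨ tr-cong (*ᴹ-cong QP (≈ᴹ-refl {M})) ⟨
    tr ((Q *ᴹ P) *ᴹ M)   ≈⟨ tr-cong (*ᴹ-assoc Q P M) ⟩
    tr (Q *ᴹ (P *ᴹ M))   ≈⟨ tr-*ᴹ-comm Q (P *ᴹ M) ⟩
    tr ((P *ᴹ M) *ᴹ Q)   ≈⟨ tr-cong (*ᴹ-cong PM (≈ᴹ-refl {Q})) ⟩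
    tr ((N *ᴹ P) *ᴹ Q)   ≈⟨ tr-cong (*ᴹ-assoc N P Q) ⟩
    tr (N *ᴹ (P *ᴹ Q))   ≈⟨ tr-cong (*ᴹ-cong (≈ᴹ-refl {N}) PQ) ⟩
    tr (N *ᴹ Iᴹ)         ≈⟨ tr-cong (*ᴹ-identityʳ N) ⟩
    tr N                 ∎
    where open ≈-Reasoning

  ∑δ-fixed : ∀ ρ (L : List (OddSubset n)) →
             ∑ L (λ A → δ (proj₁ A) (act ρ (proj₁ A))) ≈ ℕ→K K (length (filter (λ X → fixed? ρ (proj₁ X)) L))
  ∑δ-fixed ρ []      = refl
  ∑δ-fixed ρ (A ∷ L) with fixed? ρ (proj₁ A)
  ... | yes _ = +-congˡ (∑δ-fixed ρ L)
  ... | no _  = trans (+-identityˡ _) (∑δ-fixed ρ L)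

  tr-T : ∀ ρ → tr (T ρ) ≈ ℕ→K K (fixedOddCount ρ)
  tr-T ρ = ∑δ-fixed ρ Odd

ℕ→K-injective : ∀ {c ℓ} (K : CommutativeRing c ℓ) → CharZero K →
                ∀ a b → CommutativeRing._≈_ K (ℕ→K K a) (ℕ→K K b) → a ≡ b
ℕ→K-injective K cz zero    zero    e = ≡.refl
ℕ→K-injective K cz zero    (suc b) e = ⊥-elim (cz b (CommutativeRing.sym K e))
ℕ→K-injective K cz (suc a) zero    e = ⊥-elim (cz a e)
ℕ→K-injective K cz (suc a) (suc b) e = ≡.cong suc (ℕ→K-injective K cz a b (∙-cancelˡ 1# (ℕ→K K a) (ℕ→K K b) e))
  where
  open CommutativeRing K using (1#; +-abelianGroup)
  open import Algebra.Properties.AbelianGroup +-abelianGroup using (∙-cancelˡ)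

similar⇒fixedOddCount-^ₚ : ∀ {c ℓ} (K : CommutativeRing c ℓ) → CharZero K → ∀ {n} {π σ : Permutation′ n} →
  Matrices.Similar K n (Matrices.T K n π) (Matrices.T K n σ) → ∀ k → fixedOddCount (π ^ₚ k) ≡ fixedOddCount (σ ^ₚ k)
similar⇒fixedOddCount-^ₚ K cz {n} {π} {σ} sim k = ℕ→K-injective K cz _ _ (begin
  ℕ→K K (fixedOddCount (π ^ₚ k))  ≈⟨ tr-T (π ^ₚ k) ⟨
  tr (T (π ^ₚ k))                 ≈⟨ similar⇒tr≈ (similar-T-^ₚ sim k) ⟩
  tr (T (σ ^ₚ k))                 ≈⟨ tr-T (σ ^ₚ k) ⟩
  ℕ→K K (fixedOddCount (σ ^ₚ k))  ∎)
  where
  open Matrices K n using (T)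
  open MatrixAlgebra K n using (tr; tr-T; similar⇒tr≈; similar-T-^ₚ; module ≈-Reasoning)
  open ≈-Reasoning

-- Opened only from here on: the ring operations above would clash with those on ℕ.
open import Data.Nat using (_+_; _*_; _∸_; _^_; _/_; _<_; _≤_; s≤s; z≤n; NonZero; ≢-nonZero; ≢-nonZero⁻¹; >-nonZero)
open import Data.Bool using (T)
open import Data.Nat.Properties
open import Data.Nat.DivMod
  using (m≡m%n+[m/n]*n; m%n<n; %-distribˡ-+; m%n%n≡m%n; m/n*n≡m; m*[n/m]≡n; /-congʳ; %-congʳ; m≥n⇒m/n>0)
open import Data.Nat.Divisibility
open import Data.Nat.GCD
open import Data.Nat.Coprimality using (Coprime; coprime-divisor; coprime-/gcd)
open import Data.Nat.Induction using (<-rec)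
open import Data.Nat.ListAction using (sum; product)
open import Data.Nat.ListAction.Properties using (sum-++; sum-↭; ∈⇒∣product; product≢0)
open import Data.Nat.Solver using (module +-*-Solver)
open +-*-Solver using (solve; _:+_; _:*_; _:=_; con)
open import Relation.Binary.PropositionalEquality
open import Algebra.Properties.CommutativeSemigroup +-commutativeSemigroup using (interchange)

private
  variable
    A B : Set

Unique-++⁻ʳ : ∀ (xs : List A) {ys} → Unique (xs ++ ys) → Unique ys
Unique-++⁻ʳ []       u       = u
Unique-++⁻ʳ (x ∷ xs) (_ ∷ u) = Unique-++⁻ʳ xs u

Unique-++-disjoint : ∀ (xs : List A) {ys v} → Unique (xs ++ ys) → v ∈ xs → v ∈ ys → ⊥
Unique-++-disjoint (x ∷ xs) (x∉ ∷ u) (here refl) v∈ys = All.lookup x∉ (∈-++⁺ʳ xs v∈ys) refl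
Unique-++-disjoint (x ∷ xs) (_ ∷ u)  (there v∈)  v∈ys = Unique-++-disjoint xs u v∈ v∈ys

unique-set⇒↭ : ∀ {xs ys : List A} → Unique xs → Unique ys →
               (∀ {x} → x ∈ xs → x ∈ ys) → (∀ {x} → x ∈ ys → x ∈ xs) → xs ↭ ys
unique-set⇒↭ ux uy to from = ∼bag⇒↭ (unique∧set⇒bag ux uy (mk⇔ to from))

length-by-inverses : ∀ {xs : List A} {ys : List B} (f : A → B) (g : B → A) → Unique xs → Unique ys →
                     (∀ {x} → x ∈ xs → f x ∈ ys) → (∀ {y} → y ∈ ys → g y ∈ xs) →
                     (∀ {x} → x ∈ xs → g (f x) ≡ x) → (∀ {y} → y ∈ ys → f (g y) ≡ y) →
                     length xs ≡ length ys
length-by-inverses {xs = xs} {ys} f g uxs uys f∈ g∈ gf fg =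
  trans (sym (length-map f xs)) (↭.↭-length (unique-set⇒↭ (unique-map uxs λ x∈ → x∈) uys to from))
  where
  unique-map : ∀ {zs} → Unique zs → (∀ {x} → x ∈ zs → x ∈ xs) → Unique (map f zs)
  unique-map {[]}     []       _ = []
  unique-map {z ∷ zs} (z∉ ∷ u) ⊆ = All.tabulate distinct ∷ unique-map u (λ x∈ → ⊆ (there x∈))
    where
    distinct : ∀ {v} → v ∈ map f zs → f z ≢ v
    distinct v∈ fz≡v with w , w∈ , refl ← ∈-map⁻ f v∈ =
      All.lookup z∉ w∈ (trans (sym (gf (⊆ (here refl)))) (trans (cong g fz≡v) (gf (⊆ (there w∈)))))
  to : ∀ {y} → y ∈ map f xs → y ∈ ys
  to y∈ with x , x∈ , refl ← ∈-map⁻ f y∈ = f∈ x∈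
  from : ∀ {y} → y ∈ ys → y ∈ map f xs
  from y∈ = subst (_∈ map f xs) (fg y∈) (∈-map⁺ f (g∈ y∈))

sublists : List A → List (List A)
sublists []       = [] ∷ []
sublists (x ∷ xs) = sublists xs ++ map (x ∷_) (sublists xs)

∈-sublists⇒⊆ : ∀ {xs ys : List A} {x} → ys ∈ sublists xs → x ∈ ys → x ∈ xs
∈-sublists⇒⊆ {xs = []}     (here refl) ()
∈-sublists⇒⊆ {xs = y ∷ xs} ys∈ x∈ with ∈-++⁻ (sublists xs) ys∈
... | inj₁ ys∈′ = there (∈-sublists⇒⊆ ys∈′ x∈)
... | inj₂ ys∈′ with zs , zs∈ , refl ← ∈-map⁻ (y ∷_) ys∈′ with x∈
...   | here x≡y  = here x≡y
...   | there x∈′ = there (∈-sublists⇒⊆ zs∈ x∈′)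

sublists-unique : ∀ {xs : List A} → Unique xs → Unique (sublists xs)
sublists-unique {xs = []}     _         = [] ∷ []
sublists-unique {xs = x ∷ xs} (x∉ ∷ u) =
  Unique.++⁺ (sublists-unique u) (Unique.map⁺ ∷-injectiveʳ (sublists-unique u)) disjoint
  where
  disjoint : ∀ {ys} → ¬ (ys ∈ sublists xs × ys ∈ map (x ∷_) (sublists xs))
  disjoint (ys∈ , ys∈′) with zs , _ , refl ← ∈-map⁻ (x ∷_) ys∈′ =
    All.lookup x∉ (∈-sublists⇒⊆ ys∈ (here refl)) refl

sublists-map : ∀ (f : A → B) xs → sublists (map f xs) ≡ map (map f) (sublists xs)
sublists-map f []       = refl
sublists-map f (x ∷ xs) = begin
  sublists (map f xs) ++ map (f x ∷_) (sublists (map f xs))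
    ≡⟨ cong (λ s → s ++ map (f x ∷_) s) (sublists-map f xs) ⟩
  map (map f) (sublists xs) ++ map (f x ∷_) (map (map f) (sublists xs))
    ≡⟨ cong (map (map f) (sublists xs) ++_) (trans (sym (map-∘ (sublists xs))) (map-∘ (sublists xs))) ⟩
  map (map f) (sublists xs) ++ map (map f) (map (x ∷_) (sublists xs))
    ≡⟨ map-++ (map f) (sublists xs) _ ⟨
  map (map f) (sublists (x ∷ xs)) ∎
  where open ≡-Reasoning

filterᵇ∈sublists : ∀ (p : A → Bool) xs → filterᵇ p xs ∈ sublists xs
filterᵇ∈sublists p []       = here refl
filterᵇ∈sublists p (x ∷ xs) with p x
... | true  = ∈-++⁺ʳ (sublists xs) (∈-map⁺ (x ∷_) (filterᵇ∈sublists p xs))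
... | false = ∈-++⁺ˡ (filterᵇ∈sublists p xs)

filterᵇ-cong-local : ∀ (p q : A → Bool) xs → (∀ {x} → x ∈ xs → p x ≡ q x) → filterᵇ p xs ≡ filterᵇ q xs
filterᵇ-cong-local p q []       _ = refl
filterᵇ-cong-local p q (x ∷ xs) e with p x | q x | e (here refl)
... | true  | true  | _ = cong (x ∷_) (filterᵇ-cong-local p q xs (λ x∈ → e (there x∈)))
... | false | false | _ = filterᵇ-cong-local p q xs (λ x∈ → e (there x∈))

length-concatMap : ∀ (f : A → List B) xs → length (concatMap f xs) ≡ sum (map (length ∘ f) xs)
length-concatMap f []       = refl
length-concatMap f (x ∷ xs) = trans (length-++ (f x)) (cong (length (f x) +_) (length-concatMap f xs))

filter-map : ∀ {P : B → Set} (P? : Decidable P) (f : A → B) xs → filter P? (map f xs) ≡ map f (filter (P? ∘ f) xs)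
filter-map P? f []       = refl
filter-map P? f (x ∷ xs) with does (P? (f x))
... | true  = cong (f x ∷_) (filter-map P? f xs)
... | false = filter-map P? f xs

sum-map-++ : ∀ (w : A → ℕ) xs ys → sum (map w (xs ++ ys)) ≡ sum (map w xs) + sum (map w ys)
sum-map-++ w xs ys = trans (cong sum (map-++ w xs ys)) (sum-++ (map w xs) (map w ys))

sum-map-concatMap : ∀ (w : B → ℕ) (f : A → List B) xs →
                    sum (map w (concatMap f xs)) ≡ sum (map (λ x → sum (map w (f x))) xs)
sum-map-concatMap w f []       = refl
sum-map-concatMap w f (x ∷ xs) = trans (sum-map-++ w (f x) (concatMap f xs)) (cong (sum (map w (f x)) +_) (sum-map-concatMap w f xs))

sum-applyUpTo-const : ∀ (f : ℕ → ℕ) {c} m → (∀ j → f j ≡ c) → sum (applyUpTo f m) ≡ m * c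
sum-applyUpTo-const f zero    _ = refl
sum-applyUpTo-const f (suc m) e = cong₂ _+_ (e 0) (sum-applyUpTo-const (f ∘ suc) m (e ∘ suc))

sum-map-cong-local : ∀ (f g : A → ℕ) xs → (∀ {x} → x ∈ xs → f x ≡ g x) → sum (map f xs) ≡ sum (map g xs)
sum-map-cong-local f g []       _ = refl
sum-map-cong-local f g (x ∷ xs) e = cong₂ _+_ (e (here refl)) (sum-map-cong-local f g xs (e ∘ there))

sum-map-*ʳ : ∀ (f : A → ℕ) c xs → sum (map (λ x → f x * c) xs) ≡ sum (map f xs) * c
sum-map-*ʳ f c []       = refl
sum-map-*ʳ f c (x ∷ xs) = trans (cong (f x * c +_) (sum-map-*ʳ f c xs)) (sym (*-distribʳ-+ c (f x) _))

sum-map-const : ∀ c (xs : List A) → sum (map (λ _ → c) xs) ≡ length xs * c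
sum-map-const c []       = refl
sum-map-const c (x ∷ xs) = cong (c +_) (sum-map-const c xs)

sum-map-*ˡ : ∀ c (f : A → ℕ) xs → sum (map (λ x → c * f x) xs) ≡ c * sum (map f xs)
sum-map-*ˡ c f []       = sym (*-zeroʳ c)
sum-map-*ˡ c f (x ∷ xs) = trans (cong (c * f x +_) (sum-map-*ˡ c f xs)) (sym (*-distribˡ-+ c (f x) _))

partition-↭ : ∀ {P : A → Set} (P? : Decidable P) xs → xs ↭ filter P? xs ++ filter (¬? ∘ P?) xs
partition-↭ P? []       = ↭-refl
partition-↭ P? (x ∷ xs) with P? x
... | yes _ = prep x (partition-↭ P? xs)
... | no _  = ↭-trans (prep x (partition-↭ P? xs)) (↭-sym (↭.shift x (filter P? xs) (filter (¬? ∘ P?) xs)))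

all≡⇒replicate : ∀ (b : A) xs → (∀ {x} → x ∈ xs → x ≡ b) → xs ≡ replicate (length xs) b
all≡⇒replicate b []       _ = refl
all≡⇒replicate b (x ∷ xs) e = cong₂ _∷_ (e (here refl)) (all≡⇒replicate b xs (e ∘ there))

concatMap-↭ : ∀ (f : A → List B) {xs ys} → xs ↭ ys → concatMap f xs ↭ concatMap f ys
concatMap-↭ f ↭.refl          = ↭-refl
concatMap-↭ f (↭.prep x p)    = ↭.++⁺ˡ (f x) (concatMap-↭ f p)
concatMap-↭ f (↭.swap x y p)  = ↭-trans (↭.shifts (f x) (f y)) (↭.++⁺ˡ (f y) (↭.++⁺ˡ (f x) (concatMap-↭ f p)))
concatMap-↭ f (↭.trans p q)   = ↭-trans (concatMap-↭ f p) (concatMap-↭ f q)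

Unique-resp-↭ : ∀ {xs ys : List A} → xs ↭ ys → Unique xs → Unique ys
Unique-resp-↭ {A = A} p = ↭ₛ.Unique-resp-↭ (setoid A) (↭⇒↭ₛ p)

unique-key : ∀ (key : A → B) {zs} → Unique (map key zs) → ∀ {z z′} → z ∈ zs → z′ ∈ zs → key z ≡ key z′ → z ≡ z′
unique-key key (_ ∷ _) (here refl) (here refl) _ = refl
unique-key key (k∉ ∷ _) (here refl) (there z′∈) eq = ⊥-elim (All.lookup k∉ (∈-map⁺ key z′∈) eq)
unique-key key (k∉ ∷ _) (there z∈) (here refl) eq = ⊥-elim (All.lookup k∉ (∈-map⁺ key z∈) (sym eq))
unique-key key (_ ∷ u) (there z∈) (there z′∈) eq = unique-key key u z∈ z′∈ eq

private
  drop-matched : ∀ {C : Set} (f : A → C) (g : B → C) {x xs y} as bs → f x ≡ g y →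
                 map f (x ∷ xs) ↭ map g (as ++ y ∷ bs) → map f xs ↭ map g (as ++ bs)
  drop-matched f g {x} {y = y} as bs fx≡gy p = ↭.drop-∷ (↭-trans p (↭-trans (↭.map⁺ g (↭.shift y as bs))
    (subst (λ c → c ∷ map g (as ++ bs) ↭ f x ∷ map g (as ++ bs)) fx≡gy ↭-refl)))

↭-map-pairing : ∀ {C : Set} (f : A → C) (g : B → C) xs ys → map f xs ↭ map g ys →
                ∃[ zs ] map proj₁ zs ≡ xs × map proj₂ zs ↭ ys × All (λ z → f (proj₁ z) ≡ g (proj₂ z)) zs
↭-map-pairing f g []       []       p = [] , refl , ↭-refl , []
↭-map-pairing f g []       (y ∷ ys) p with () ← ↭.↭-empty-inv (↭-sym p)
↭-map-pairing f g (x ∷ xs) ys       p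
  with y , y∈ , fx≡gy ← ∈-map⁻ g (↭.∈-resp-↭ p (here refl))
  with as , bs , refl ← ∈-∃++ y∈
  with zs , proj₁≡ , proj₂↭ , same ← ↭-map-pairing f g xs (as ++ bs) (drop-matched f g as bs fx≡gy p)
  = (x , y) ∷ zs , cong (x ∷_) proj₁≡ , ↭-trans (prep y proj₂↭) (↭-sym (↭.shift y as bs)) , fx≡gy ∷ same

sumBelow : ℕ → (ℕ → ℕ) → ℕ
sumBelow zero    F = 0
sumBelow (suc m) F = F 0 + sumBelow m (λ i → F (suc i))

infixl 10 sumBelow
syntax sumBelow m (λ i → e) = ∑[ i < m ] e

sumBelow-cong : ∀ m {F G : ℕ → ℕ} → (∀ i → i < m → F i ≡ G i) → ∑[ i < m ] F i ≡ ∑[ i < m ] G i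
sumBelow-cong zero    e = refl
sumBelow-cong (suc m) e = cong₂ _+_ (e 0 (s≤s z≤n)) (sumBelow-cong m (λ i i<m → e (suc i) (s≤s i<m)))

sumBelow-zero : ∀ m {F : ℕ → ℕ} → (∀ i → i < m → F i ≡ 0) → ∑[ i < m ] F i ≡ 0
sumBelow-zero zero    e = refl
sumBelow-zero (suc m) e = cong₂ _+_ (e 0 (s≤s z≤n)) (sumBelow-zero m (λ i i<m → e (suc i) (s≤s i<m)))

sumBelow-one : ∀ m → ∑[ i < m ] 1 ≡ m
sumBelow-one zero    = refl
sumBelow-one (suc m) = cong suc (sumBelow-one m)

sumBelow-+ : ∀ m (F G : ℕ → ℕ) → ∑[ i < m ] (F i + G i) ≡ ∑[ i < m ] F i + ∑[ i < m ] G i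
sumBelow-+ zero    F G = refl
sumBelow-+ (suc m) F G = trans (cong (F 0 + G 0 +_) (sumBelow-+ m _ _)) (interchange (F 0) (G 0) _ _)

sumBelow-comm : ∀ a b (F : ℕ → ℕ → ℕ) → ∑[ i < a ] ∑[ j < b ] F i j ≡ ∑[ j < b ] ∑[ i < a ] F i j
sumBelow-comm zero    b F = sym (sumBelow-zero b (λ _ _ → refl))
sumBelow-comm (suc a) b F = trans (cong (sumBelow b (F 0) +_) (sumBelow-comm a b (λ i → F (suc i))))
                                  (sym (sumBelow-+ b (F 0) (λ j → ∑[ i < a ] F (suc i) j)))

sumBelow-split : ∀ a b F → ∑[ i < a + b ] F i ≡ ∑[ i < a ] F i + ∑[ r < b ] F (a + r)
sumBelow-split zero    b F = refl
sumBelow-split (suc a) b F = trans (cong (F 0 +_) (sumBelow-split a b (λ i → F (suc i)))) (sym (+-assoc (F 0) _ _))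

sumBelow-blocks : ∀ d c F → ∑[ i < d * c ] F i ≡ ∑[ j < d ] ∑[ r < c ] F (j * c + r)
sumBelow-blocks zero    c F = refl
sumBelow-blocks (suc d) c F = trans (sumBelow-split c (d * c) F)
  (cong (sumBelow c F +_) (trans (sumBelow-blocks d c (λ x → F (c + x)))
     (sumBelow-cong d (λ j _ → sumBelow-cong c (λ r _ → cong F (sym (+-assoc c (j * c) r)))))))

sum-map-sumBelow : ∀ {A : Set} (L : List A) m (F : A → ℕ → ℕ) →
                   sum (map (λ x → ∑[ i < m ] F x i) L) ≡ ∑[ i < m ] sum (map (λ x → F x i) L)
sum-map-sumBelow []      m F = sym (sumBelow-zero m (λ _ _ → refl))
sum-map-sumBelow (x ∷ L) m F = trans (cong (sumBelow m (F x) +_) (sum-map-sumBelow L m F))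
                                     (sym (sumBelow-+ m (F x) (λ i → sum (map (λ y → F y i) L))))

sumBelow-point : ∀ m (F G : ℕ → ℕ) i₀ → i₀ < m → (∀ i → i < m → i ≢ i₀ → F i ≡ G i) →
                 ∑[ i < m ] F i ≡ ∑[ i < m ] G i → F i₀ ≡ G i₀
sumBelow-point (suc m) F G zero _ others total =
  +-cancelʳ-≡ (∑[ i < m ] F (suc i)) (F 0) (G 0)
    (trans total (cong (G 0 +_) (sym (sumBelow-cong m (λ i i<m → others (suc i) (s≤s i<m) (λ ()))))))
sumBelow-point (suc m) F G (suc i₀) (s≤s i₀<m) others total =
  sumBelow-point m (λ i → F (suc i)) (λ i → G (suc i)) i₀ i₀<m
    (λ i i<m i≢i₀ → others (suc i) (s≤s i<m) (λ e → i≢i₀ (suc-injective e)))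
    (+-cancelˡ-≡ (F 0) _ _ (trans total (cong (_+ ∑[ i < m ] G (suc i)) (sym (others 0 (s≤s z≤n) (λ ()))))))

⟦_⟧ : ∀ {A : Set} → Dec A → ℕ
⟦ a? ⟧ = boolToℕ (does a?)

sumBelow-single : ∀ m {P : ℕ → Set} (P? : ∀ i → Dec (P i)) i₀ → i₀ < m → P i₀ → (∀ i → i < m → P i → i ≡ i₀) →
                  ∑[ i < m ] ⟦ P? i ⟧ ≡ 1
sumBelow-single (suc m) P? zero _ P0 unique with P? 0
... | yes _  = cong suc (sumBelow-zero m rest)
  where
  rest : ∀ i → i < m → ⟦ P? (suc i) ⟧ ≡ 0
  rest i i<m = cong boolToℕ (dec-false (P? (suc i)) (λ Pi → 1+n≢0 (unique (suc i) (s≤s i<m) Pi)))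
... | no ¬P0 = ⊥-elim (¬P0 P0)
sumBelow-single (suc m) P? (suc i₀) (s≤s i₀<m) Pi₀ unique with P? 0
... | yes P0 = ⊥-elim (0≢1+n (unique 0 (s≤s z≤n) P0))
... | no _   = sumBelow-single m (λ i → P? (suc i)) i₀ i₀<m Pi₀ (λ i i<m Pi → suc-injective (unique (suc i) (s≤s i<m) Pi))

sumBelow-positive : ∀ m {P : ℕ → Set} (P? : ∀ i → Dec (P i)) i₀ → i₀ < m → P i₀ → 1 ≤ ∑[ i < m ] ⟦ P? i ⟧
sumBelow-positive (suc m) P? zero _ P0 rewrite dec-true (P? 0) P0 = s≤s z≤n
sumBelow-positive (suc m) P? (suc i₀) (s≤s i₀<m) Pi₀ =
  ≤-trans (sumBelow-positive m (λ i → P? (suc i)) i₀ i₀<m Pi₀) (m≤n+m _ ⟦ P? 0 ⟧)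

least : ∀ {P : ℕ → Set} → Decidable P → ∀ m → P m → ∃[ p ] P p × (∀ q → q < p → ¬ P q)
least {P} P? m pm = search 0 (λ _ ()) m (subst P (sym (+-identityˡ m)) pm)
  where
  search : ∀ k → (∀ q → q < k → ¬ P q) → ∀ m → P (k + m) → ∃[ p ] P p × (∀ q → q < p → ¬ P q)
  search k below zero pkm = k , subst P (+-identityʳ k) pkm , below
  search k below (suc m) pkm with P? k
  ... | yes pk = k , pk , below
  ... | no ¬pk = search (suc k) below′ m (subst P (+-suc k m) pkm)
    where
    below′ : ∀ q → q < suc k → ¬ P q
    below′ q q<1+k with m≤n⇒m<n∨m≡n (≤-pred q<1+k)
    ... | inj₁ q<k = below q q<k
    ... | inj₂ refl = ¬pk

module Cycles {n : ℕ} (ρ : Permutation′ n) where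

  open import Data.List.Membership.DecPropositional (Data.Fin._≟_ {n}) using (_∈?_)

  iter : ℕ → Fin n → Fin n
  iter j x = ρ ^ₚ j ⟨$⟩ʳ x

  iter-+ : ∀ a b x → iter (a + b) x ≡ iter a (iter b x)
  iter-+ zero    b x = refl
  iter-+ (suc a) b x = cong (ρ ⟨$⟩ʳ_) (iter-+ a b x)

  iter-comm : ∀ a b x → iter a (iter b x) ≡ iter b (iter a x)
  iter-comm a b x = trans (sym (iter-+ a b x)) (trans (cong (λ m → iter m x) (+-comm a b)) (iter-+ b a x))

  iter-injective : ∀ j {x y} → iter j x ≡ iter j y → x ≡ y
  iter-injective zero    e = e
  iter-injective (suc j) e =
    iter-injective j (trans (sym (inverseˡ ρ)) (trans (cong (ρ ⟨$⟩ˡ_) e) (inverseˡ ρ)))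

  private
    returns : ∀ x → ∃[ m ] iter (suc m) x ≡ x
    returns x with Fin.pigeonhole (n<1+n n) (λ (i : Fin (suc n)) → iter (toℕ i) x)
    ... | i , j , i<j , e = toℕ j ∸ suc (toℕ i) ,
      iter-injective (toℕ i) (trans (sym (iter-+ (toℕ i) _ x))
        (trans (cong (λ m → iter m x) (trans (+-suc (toℕ i) _) (m+[n∸m]≡n i<j))) (sym e)))

    firstReturn : ∀ x → ∃[ p ] iter (suc p) x ≡ x × (∀ q → q < p → iter (suc q) x ≢ x)
    firstReturn x = least (λ q → iter (suc q) x Data.Fin.≟ x) (proj₁ (returns x)) (proj₂ (returns x))

  opaque
    period : Fin n → ℕ
    period x = suc (proj₁ (firstReturn x))

    iter-period : ∀ x → iter (period x) x ≡ x
    iter-period x = proj₁ (proj₂ (firstReturn x))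

    iter≢-below-period : ∀ x q → 0 < q → q < period x → iter q x ≢ x
    iter≢-below-period x (suc q) _ (s≤s q<p) = proj₂ (proj₂ (firstReturn x)) q q<p

    period>0 : ∀ x → 0 < period x
    period>0 x = s≤s z≤n

  instance
    period≢0 : ∀ {x} → NonZero (period x)
    period≢0 {x} = >-nonZero (period>0 x)

  iter-*period : ∀ x q → iter (q * period x) x ≡ x
  iter-*period x zero    = refl
  iter-*period x (suc q) =
    trans (iter-+ (period x) (q * period x) x) (trans (cong (iter (period x)) (iter-*period x q)) (iter-period x))

  iter-%period : ∀ x m → iter m x ≡ iter (m % period x) x
  iter-%period x m = trans (cong (λ k → iter k x) (m≡m%n+[m/n]*n m (period x)))
    (trans (iter-+ (m % period x) _ x) (cong (iter (m % period x)) (iter-*period x (m / period x))))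

  iter≡⇒period∣ : ∀ x m → iter m x ≡ x → period x ∣ m
  iter≡⇒period∣ x m e with m % period x in r
  ... | zero  = m%n≡0⇒n∣m m (period x) r
  ... | suc q = ⊥-elim (iter≢-below-period x (suc q) (s≤s z≤n) (subst (_< period x) r (m%n<n m (period x)))
                         (trans (cong (λ k → iter k x) (sym r)) (trans (sym (iter-%period x m)) e)))

  period∣⇒iter≡ : ∀ x m → period x ∣ m → iter m x ≡ x
  period∣⇒iter≡ x .(q * period x) (divides q refl) = iter-*period x q

  period-iter : ∀ j x → period (iter j x) ≡ period x
  period-iter j x = ∣-antisym
    (iter≡⇒period∣ (iter j x) (period x) (trans (iter-comm (period x) j x) (cong (iter j) (iter-period x))))
    (iter≡⇒period∣ x (period (iter j x)) (iter-injective j (trans (iter-comm j (period (iter j x)) x) (iter-period (iter j x)))))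

  orbit : Fin n → List (Fin n)
  orbit x = applyUpTo (λ j → iter j x) (period x)

  orbit-unique : ∀ x → Unique (orbit x)
  orbit-unique x = Unique.applyUpTo⁺₁ (λ j → iter j x) (period x) distinct
    where
    distinct : ∀ {i j} → i < j → j < period x → iter i x ≢ iter j x
    distinct {i} {j} i<j j<p e = iter≢-below-period x (j ∸ i) (m<n⇒0<n∸m i<j) (≤-<-trans (m∸n≤m j i) j<p)
      (iter-injective i (trans (sym (iter-+ i (j ∸ i) x))
        (trans (cong (λ k → iter k x) (m+[n∸m]≡n (<⇒≤ i<j))) (sym e))))

  iter∈orbit : ∀ x m → iter m x ∈ orbit x
  iter∈orbit x m =
    subst (_∈ orbit x) (sym (iter-%period x m)) (∈-applyUpTo⁺ (λ j → iter j x) (m%n<n m (period x)))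

  ∈orbit⇒iter : ∀ {x y} → y ∈ orbit x → ∃[ j ] y ≡ iter j x
  ∈orbit⇒iter {x} y∈ with j , _ , e ← ∈-applyUpTo⁻ (λ j → iter j x) y∈ = j , e

  x∈orbit : ∀ x → x ∈ orbit x
  x∈orbit x = iter∈orbit x 0

  orbit-closed : ∀ {x y} m → y ∈ orbit x → iter m y ∈ orbit x
  orbit-closed {x} m y∈ with j , refl ← ∈orbit⇒iter y∈ = subst (_∈ orbit x) (iter-+ m j x) (iter∈orbit x (m + j))

  orbit-sym : ∀ {x y} → y ∈ orbit x → x ∈ orbit y
  orbit-sym {x} y∈ with ∈-applyUpTo⁻ (λ j → iter j x) y∈
  ... | j , j<p , refl = subst (_∈ orbit (iter j x)) back (iter∈orbit (iter j x) (period x ∸ j))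
    where
    back : iter (period x ∸ j) (iter j x) ≡ x
    back = trans (sym (iter-+ (period x ∸ j) j x))
             (trans (cong (λ k → iter k x) (m∸n+n≡m (<⇒≤ j<p))) (iter-period x))

  orbits : List (Fin n) → List (Fin n)
  orbits = concatMap orbit

  ∈orbits⁻ : ∀ {D z} → z ∈ orbits D → ∃[ x ] x ∈ D × ∃[ j ] z ≡ iter j x
  ∈orbits⁻ {D} z∈ with x , x∈ , z∈o ← find (∈-concatMap⁻ orbit {xs = D} z∈) = x , x∈ , ∈orbit⇒iter z∈o

  ∈orbits⁺ : ∀ {D x z} → x ∈ D → z ∈ orbit x → z ∈ orbits D
  ∈orbits⁺ {D} x∈ z∈ = ∈-concatMap⁺ orbit {xs = D} (Any.map (λ { refl → z∈ }) x∈)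

  orbits-closed : ∀ D {y} m → y ∈ orbits D → iter m y ∈ orbits D
  orbits-closed D m y∈ = ∈-concatMap⁺ orbit (Any.map (orbit-closed m) (∈-concatMap⁻ orbit {xs = D} y∈))

  orbit-disjoint : ∀ {D z} → z ∉ orbits D → ∀ {v} → ¬ (v ∈ orbit z × v ∈ orbits D)
  orbit-disjoint {D} z∉ (v∈o , v∈D) with j , e ← ∈orbit⇒iter (orbit-sym v∈o) =
    z∉ (subst (_∈ orbits D) (sym e) (orbits-closed D j v∈D))

  record Transversal (D : List (Fin n)) : Set where
    constructor transversalOf
    field
      unique : Unique (orbits D)
      covers : ∀ z → z ∈ orbits D

  private
    extend : (L D : List (Fin n)) → Unique (orbits D) →
             Σ (List (Fin n)) λ D′ →
               Unique (orbits D′) × All (_∈ orbits D′) L × (∀ {z} → z ∈ orbits D → z ∈ orbits D′)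
    extend [] D u = D , u , [] , λ z∈ → z∈
    extend (z ∷ L) D u with z ∈? orbits D
    ... | yes z∈ = let D′ , u′ , covers , grows = extend L D u in D′ , u′ , grows z∈ ∷ covers , grows
    ... | no z∉ =
      let D′ , u′ , covers , grows = extend L (z ∷ D) (Unique.++⁺ (orbit-unique z) u (orbit-disjoint {D} z∉))
      in D′ , u′ , grows (∈-++⁺ˡ (x∈orbit z)) ∷ covers , λ w∈ → grows (∈-++⁺ʳ (orbit z) w∈)

  transversal : Σ (List (Fin n)) Transversal
  transversal = let D , u , covers , _ = extend (allFin n) [] [] in D , transversalOf u λ z → All.lookup covers (∈-allFin z)

  iter-pred-period : ∀ x → iter (period x ∸ 1) (ρ ⟨$⟩ʳ x) ≡ x
  iter-pred-period x = trans (sym (iter-+ (period x ∸ 1) 1 x))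
    (trans (cong (λ k → iter k x) (m∸n+n≡m (period>0 x))) (iter-period x))

  sum-orbit-invariant : ∀ (w : Fin n → ℕ) x → (∀ j → w (iter j x) ≡ w x) → sum (map w (orbit x)) ≡ period x * w x
  sum-orbit-invariant w x inv = trans (cong sum (map-applyUpTo (λ j → iter j x) w (period x)))
                                      (sum-applyUpTo-const (λ j → w (iter j x)) (period x) inv)

  transversal-↭ : ∀ {D} → Transversal D → orbits D ↭ allFin n
  transversal-↭ (transversalOf u covers) = unique-set⇒↭ u (Unique.allFin⁺ n) (λ {z} _ → ∈-allFin z) (λ {z} _ → covers z)

  sum-transversal : ∀ {D} → Transversal D → ∀ (w : Fin n → ℕ) →
                    sum (map (λ x → sum (map w (orbit x))) D) ≡ sum (map w (allFin n))
  sum-transversal {D} tr w = trans (sym (sum-map-concatMap w orbit D)) (sum-↭ (↭.map⁺ w (transversal-↭ tr)))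

  transversal-resp-↭ : ∀ {D D′} → D ↭ D′ → Transversal D → Transversal D′
  transversal-resp-↭ {D} {D′} p (transversalOf u covers) =
    transversalOf (Unique-resp-↭ orbits↭ u) λ z → ↭.∈-resp-↭ orbits↭ (covers z)
    where
    orbits↭ : orbits D ↭ orbits D′
    orbits↭ = concatMap-↭ orbit p

∣tabulate∣ : ∀ {n m} (g : Fin n → Bool) (h : Fin m → Fin n) →
             ∣ tabulate (λ i → g (h i)) ∣ ≡ length (filterᵇ g (List.tabulate h))
∣tabulate∣ {m = zero}  g h = refl
∣tabulate∣ {m = suc m} g h with g (h zero)
... | true  = cong suc (∣tabulate∣ g (λ i → h (suc i)))
... | false = ∣tabulate∣ g (λ i → h (suc i))

module FixedSubsets {n : ℕ} (ρ : Permutation′ n) where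
  open Cycles ρ
  open import Data.List.Membership.DecPropositional (Data.Fin._≟_ {n}) using (_∈?_)

  Invariant : Subset n → Set
  Invariant A = ∀ z → lookup A (ρ ⟨$⟩ʳ z) ≡ lookup A z

  fixed⇒invariant : ∀ {A} → A ≡ act ρ A → Invariant A
  fixed⇒invariant {A} A≡ z = begin
    lookup A (ρ ⟨$⟩ʳ z)                ≡⟨ cong (λ B → lookup B (ρ ⟨$⟩ʳ z)) A≡ ⟩
    lookup (act ρ A) (ρ ⟨$⟩ʳ z)        ≡⟨ Vec.lookup∘tabulate (λ j → lookup A (ρ ⟨$⟩ˡ j)) (ρ ⟨$⟩ʳ z) ⟩
    lookup A (ρ ⟨$⟩ˡ (ρ ⟨$⟩ʳ z))       ≡⟨ cong (lookup A) (inverseˡ ρ) ⟩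
    lookup A z                         ∎
    where open ≡-Reasoning

  invariant⇒fixed : ∀ {A} → Invariant A → A ≡ act ρ A
  invariant⇒fixed {A} inv = trans (sym (Vec.tabulate∘lookup A))
    (Vec.tabulate-cong (λ j → trans (cong (lookup A) (sym (inverseʳ ρ))) (inv (ρ ⟨$⟩ˡ j))))

  invariant-iter : ∀ {A} → Invariant A → ∀ m z → lookup A (iter m z) ≡ lookup A z
  invariant-iter inv zero    z = refl
  invariant-iter {A} inv (suc m) z = trans (inv (iter m z)) (invariant-iter {A} inv m z)

  orbitUnion : List (Fin n) → Subset n
  orbitUnion S = tabulate (λ z → does (z ∈? orbits S))

  lookup-orbitUnion : ∀ S z → lookup (orbitUnion S) z ≡ does (z ∈? orbits S)
  lookup-orbitUnion S = Vec.lookup∘tabulate (λ z → does (z ∈? orbits S))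

  orbitUnion-invariant : ∀ S → Invariant (orbitUnion S)
  orbitUnion-invariant S z = trans (lookup-orbitUnion S (ρ ⟨$⟩ʳ z))
    (trans (does-⇔ (mk⇔ back (orbits-closed S 1)) (ρ ⟨$⟩ʳ z ∈? orbits S) (z ∈? orbits S))
           (sym (lookup-orbitUnion S z)))
    where
    back : ρ ⟨$⟩ʳ z ∈ orbits S → z ∈ orbits S
    back ρz∈ = subst (_∈ orbits S) (iter-pred-period z) (orbits-closed S (period z ∸ 1) ρz∈)

  T-orbitUnion : ∀ S z → T (lookup (orbitUnion S) z) ⇔ z ∈ orbits S
  T-orbitUnion S z rewrite lookup-orbitUnion S z with z ∈? orbits S
  ... | yes z∈ = mk⇔ (λ _ → z∈) _
  ... | no z∉  = mk⇔ (λ ()) z∉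

  restrict : Subset n → List (Fin n) → List (Fin n)
  restrict A = filterᵇ (lookup A)

  ∈-restrict⁻ : ∀ {A D x} → x ∈ restrict A D → x ∈ D × T (lookup A x)
  ∈-restrict⁻ {A} = ∈-filter⁻ (T? ∘ lookup A)

  ∈-restrict⁺ : ∀ {A D x} → x ∈ D → T (lookup A x) → x ∈ restrict A D
  ∈-restrict⁺ {A} = ∈-filter⁺ (T? ∘ lookup A)

  ∈-orbits-restrict : ∀ {D} → Transversal D → ∀ {A} → Invariant A → ∀ z → z ∈ orbits (restrict A D) ⇔ T (lookup A z)
  ∈-orbits-restrict {D} (transversalOf _ covers) {A} inv z = mk⇔ to from
    where
    to : z ∈ orbits (restrict A D) → T (lookup A z)
    to z∈ with x , x∈ , j , refl ← ∈orbits⁻ {restrict A D} z∈ =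
      subst T (sym (invariant-iter {A} inv j x)) (proj₂ (∈-restrict⁻ {A} {D} x∈))
    from : T (lookup A z) → z ∈ orbits (restrict A D)
    from Az with x , x∈ , j , refl ← ∈orbits⁻ {D} (covers z) =
      ∈orbits⁺ {restrict A D} (∈-restrict⁺ {A} x∈ (subst T (invariant-iter {A} inv j x) Az)) (iter∈orbit x j)

  orbitUnion-restrict : ∀ {D} → Transversal D → ∀ {A} → Invariant A → orbitUnion (restrict A D) ≡ A
  orbitUnion-restrict {D} tr {A} inv = trans
    (Vec.tabulate-cong (λ z → does-⇔ (∈-orbits-restrict tr {A} inv z) (z ∈? orbits (restrict A D)) (T? (lookup A z))))
    (Vec.tabulate∘lookup A)

  orbits-mono : ∀ {S D} → (∀ {x} → x ∈ S → x ∈ D) → ∀ {z} → z ∈ orbits S → z ∈ orbits D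
  orbits-mono {S} {D} S⊆D z∈ with x , x∈ , j , refl ← ∈orbits⁻ {S} z∈ = ∈orbits⁺ {D} (S⊆D x∈) (iter∈orbit x j)

  orbits-unique-sublist : ∀ {D S} → Unique (orbits D) → S ∈ sublists D → Unique (orbits S)
  orbits-unique-sublist {[]}    u (here refl) = []
  orbits-unique-sublist {d ∷ D} u S∈ with ∈-++⁻ (sublists D) S∈
  ... | inj₁ S∈′ = orbits-unique-sublist {D} (Unique-++⁻ʳ (orbit d) u) S∈′
  ... | inj₂ S∈′ with S′ , S′∈ , refl ← ∈-map⁻ (d ∷_) S∈′ =
    Unique.++⁺ (orbit-unique d) (orbits-unique-sublist {D} (Unique-++⁻ʳ (orbit d) u) S′∈)
      (λ (v∈o , v∈S′) → Unique-++-disjoint (orbit d) u v∈o (orbits-mono {S′} {D} (∈-sublists⇒⊆ S′∈) v∈S′))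

  restrict-orbitUnion : ∀ {D S} → Unique (orbits D) → S ∈ sublists D → restrict (orbitUnion S) D ≡ S
  restrict-orbitUnion {[]}    u (here refl) = refl
  restrict-orbitUnion {d ∷ D} {S} u S∈ with ∈-++⁻ (sublists D) S∈
  ... | inj₁ S∈′ = trans (filter-reject (T? ∘ lookup (orbitUnion S)) {x = d} {xs = D} d∉)
                         (restrict-orbitUnion {D} (Unique-++⁻ʳ (orbit d) u) S∈′)
    where
    d∉ : ¬ T (lookup (orbitUnion S) d)
    d∉ d∈ = Unique-++-disjoint (orbit d) u (x∈orbit d)
              (orbits-mono {S} {D} (∈-sublists⇒⊆ S∈′) (Equivalence.to (T-orbitUnion S d) d∈))
  ... | inj₂ S∈′ with S′ , S′∈ , refl ← ∈-map⁻ (d ∷_) S∈′ = begin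
    filterᵇ (lookup (orbitUnion (d ∷ S′))) (d ∷ D)
      ≡⟨ filter-accept (T? ∘ lookup (orbitUnion (d ∷ S′))) {x = d} {xs = D}
           (Equivalence.from (T-orbitUnion (d ∷ S′) d) (∈-++⁺ˡ (x∈orbit d))) ⟩
    d ∷ filterᵇ (lookup (orbitUnion (d ∷ S′))) D
      ≡⟨ cong (d ∷_) (filterᵇ-cong-local _ _ D same) ⟩
    d ∷ filterᵇ (lookup (orbitUnion S′)) D
      ≡⟨ cong (d ∷_) (restrict-orbitUnion {D} (Unique-++⁻ʳ (orbit d) u) S′∈) ⟩
    d ∷ S′ ∎
    where
    open ≡-Reasoning
    same : ∀ {x} → x ∈ D → lookup (orbitUnion (d ∷ S′)) x ≡ lookup (orbitUnion S′) x
    same {x} x∈ = trans (lookup-orbitUnion (d ∷ S′) x)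
      (trans (does-⇔ (mk⇔ drop-d (∈-++⁺ʳ (orbit d))) (x ∈? orbits (d ∷ S′)) (x ∈? orbits S′))
             (sym (lookup-orbitUnion S′ x)))
      where
      drop-d : x ∈ orbit d ++ orbits S′ → x ∈ orbits S′
      drop-d x∈′ with ∈-++⁻ (orbit d) x∈′
      ... | inj₂ x∈S′ = x∈S′
      ... | inj₁ x∈o  = ⊥-elim (Unique-++-disjoint (orbit d) u x∈o (∈orbits⁺ {D} x∈ (x∈orbit x)))

  orbits-unique⇒unique : ∀ {D} → Unique (orbits D) → Unique D
  orbits-unique⇒unique {[]}    u = []
  orbits-unique⇒unique {d ∷ D} u =
    All.tabulate (λ d′∈ d≡d′ → Unique-++-disjoint (orbit d) u (x∈orbit d)
                                 (∈orbits⁺ {D} d′∈ (subst (λ v → d ∈ orbit v) d≡d′ (x∈orbit d))))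
    ∷ orbits-unique⇒unique {D} (Unique-++⁻ʳ (orbit d) u)

  ∣orbitUnion∣ : ∀ S → Unique (orbits S) → ∣ orbitUnion S ∣ ≡ sum (map period S)
  ∣orbitUnion∣ S u = begin
    ∣ orbitUnion S ∣                 ≡⟨ ∣tabulate∣ (λ z → does (z ∈? orbits S)) (λ z → z) ⟩
    length (filterᵇ p (allFin n))    ≡⟨ ↭.↭-length (unique-set⇒↭ (Unique.filter⁺ (T? ∘ p) (Unique.allFin⁺ n)) u to from) ⟩
    length (orbits S)                ≡⟨ length-concatMap orbit S ⟩
    sum (map (length ∘ orbit) S)     ≡⟨ cong sum (map-cong (λ x → length-applyUpTo (λ j → iter j x) (period x)) S) ⟩
    sum (map period S)               ∎
    where
    open ≡-Reasoning
    p : Fin n → Bool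
    p z = does (z ∈? orbits S)
    to : ∀ {z} → z ∈ filterᵇ p (allFin n) → z ∈ orbits S
    to {z} z∈ = Equivalence.to (T-orbitUnion S z)
      (subst T (sym (lookup-orbitUnion S z)) (proj₂ (∈-filter⁻ (T? ∘ p) {xs = allFin n} z∈)))
    from : ∀ {z} → z ∈ orbits S → z ∈ filterᵇ p (allFin n)
    from {z} z∈ = ∈-filter⁺ (T? ∘ p) (∈-allFin z) (subst T (lookup-orbitUnion S z) (Equivalence.from (T-orbitUnion S z) z∈))

  fixedOddSubsets : List (Subset n)
  fixedOddSubsets = filter (fixed? ρ) (filter oddSize? (allSubsets n))

  oddPeriodSum? : (S : List (Fin n)) → Dec (IsOdd (sum (map period S)))
  oddPeriodSum? S = odd? (sum (map period S))

  oddSelections : List (Fin n) → List (List (Fin n))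
  oddSelections D = filter oddPeriodSum? (sublists D)

  length-fixedOddSubsets : ∀ {D} → Transversal D → length fixedOddSubsets ≡ length (oddSelections D)
  length-fixedOddSubsets {D} tr@(transversalOf u _) = length-by-inverses (λ A → restrict A D) orbitUnion
    (Unique.filter⁺ (fixed? ρ) (Unique.filter⁺ oddSize? (allSubsets-unique n)))
    (Unique.filter⁺ oddPeriodSum? (sublists-unique (orbits-unique⇒unique {D} u)))
    restrict∈ orbitUnion∈ orbitUnion-restrict′
    (λ S∈ → restrict-orbitUnion {D} u (proj₁ (∈-filter⁻ oddPeriodSum? {xs = sublists D} S∈)))
    where
    fixedOdd⁻ : ∀ {A} → A ∈ fixedOddSubsets → IsOdd ∣ A ∣ × A ≡ act ρ A
    fixedOdd⁻ A∈ with A∈′ , fixed ← ∈-filter⁻ (fixed? ρ) {xs = filter oddSize? (allSubsets n)} A∈ =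
      proj₂ (∈-filter⁻ oddSize? {xs = allSubsets n} A∈′) , fixed
    restrict∈ : ∀ {A} → A ∈ fixedOddSubsets → restrict A D ∈ oddSelections D
    restrict∈ {A} A∈ with odd , fixed ← fixedOdd⁻ A∈ = ∈-filter⁺ oddPeriodSum? sub (subst IsOdd ∣A∣≡ odd)
      where
      sub : restrict A D ∈ sublists D
      sub = filterᵇ∈sublists (lookup A) D
      ∣A∣≡ : ∣ A ∣ ≡ sum (map period (restrict A D))
      ∣A∣≡ = trans (cong ∣_∣ (sym (orbitUnion-restrict tr {A} (fixed⇒invariant fixed))))
                   (∣orbitUnion∣ (restrict A D) (orbits-unique-sublist {D} u sub))
    orbitUnion∈ : ∀ {S} → S ∈ oddSelections D → orbitUnion S ∈ fixedOddSubsets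
    orbitUnion∈ {S} S∈ with sub , odd ← ∈-filter⁻ oddPeriodSum? {xs = sublists D} S∈ =
      ∈-filter⁺ (fixed? ρ) (∈-filter⁺ oddSize? (allSubsets-complete n (orbitUnion S))
                             (subst IsOdd (sym (∣orbitUnion∣ S (orbits-unique-sublist {D} u sub))) odd))
                           (invariant⇒fixed {orbitUnion S} (orbitUnion-invariant S))
    orbitUnion-restrict′ : ∀ {A} → A ∈ fixedOddSubsets → orbitUnion (restrict A D) ≡ A
    orbitUnion-restrict′ {A} A∈ = orbitUnion-restrict tr {A} (fixed⇒invariant (proj₂ (fixedOdd⁻ A∈)))

  fixedOddCount≡length : fixedOddCount ρ ≡ length fixedOddSubsets
  fixedOddCount≡length = begin
    length (filter (fixed? ρ ∘ proj₁) (oddSubsets n))          ≡⟨ length-map proj₁ (filter (fixed? ρ ∘ proj₁) (oddSubsets n)) ⟨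
    length (map proj₁ (filter (fixed? ρ ∘ proj₁) (oddSubsets n))) ≡⟨ cong length (filter-map (fixed? ρ) proj₁ (oddSubsets n)) ⟨
    length (filter (fixed? ρ) (map proj₁ (oddSubsets n)))       ≡⟨ cong (length ∘ filter (fixed? ρ)) (proj₁-oddSubsets n) ⟩
    length fixedOddSubsets                                      ∎
    where open ≡-Reasoning

¬odd⇒even : ∀ m → ¬ IsOdd m → m % 2 ≡ 0
¬odd⇒even m ¬odd with m % 2 | m%n<n m 2
... | 0 | _ = refl
... | 1 | _ = ⊥-elim (¬odd refl)
... | suc (suc _) | s≤s (s≤s ())

odd⇒∤2 : ∀ {m} → IsOdd m → ¬ 2 ∣ m
odd⇒∤2 {m} odd 2∣m = 0≢1+n (trans (sym (n∣m⇒m%n≡0 m 2 2∣m)) odd)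

¬odd⇒2∣ : ∀ {m} → ¬ IsOdd m → 2 ∣ m
¬odd⇒2∣ {m} ¬odd = m%n≡0⇒n∣m m 2 (¬odd⇒even m ¬odd)

∤2⇒odd : ∀ {m} → ¬ 2 ∣ m → IsOdd m
∤2⇒odd {m} 2∤m with odd? m
... | yes odd = odd
... | no ¬odd = ⊥-elim (2∤m (¬odd⇒2∣ ¬odd))

odd-∣ : ∀ {a b} → b ∣ a → IsOdd a → IsOdd b
odd-∣ b∣a odd = ∤2⇒odd (λ 2∣b → odd⇒∤2 odd (∣-trans 2∣b b∣a))

%2-+even : ∀ c l → l % 2 ≡ 0 → (c + l) % 2 ≡ c % 2
%2-+even c l even = begin
  (c + l) % 2          ≡⟨ %-distribˡ-+ c l 2 ⟩
  (c % 2 + l % 2) % 2  ≡⟨ cong (λ x → (c % 2 + x) % 2) even ⟩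
  (c % 2 + 0) % 2      ≡⟨ cong (_% 2) (+-identityʳ (c % 2)) ⟩
  c % 2 % 2            ≡⟨ m%n%n≡m%n c 2 ⟩
  c % 2                ∎
  where open ≡-Reasoning

%2-+odd : ∀ c l → IsOdd l → c % 2 + (c + l) % 2 ≡ 1
%2-+odd c l odd = trans (cong (c % 2 +_) (trans (%-distribˡ-+ c l 2) (cong (λ x → (c % 2 + x) % 2) odd)))
                        (flip-parity (c % 2) (m%n<n c 2))
  where
  flip-parity : ∀ r → r < 2 → r + (r + 1) % 2 ≡ 1
  flip-parity 0 _ = refl
  flip-parity 1 _ = refl
  flip-parity (suc (suc _)) (s≤s (s≤s ()))

oddSum? : ∀ c (S : List ℕ) → Dec (IsOdd (c + sum S))
oddSum? c S = odd? (c + sum S)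

oddSumCount : ℕ → List ℕ → ℕ
oddSumCount c L = length (filter (oddSum? c) (sublists L))

oddSumCount-[] : ∀ c → oddSumCount c [] ≡ c % 2
oddSumCount-[] c with odd? (c + 0)
... | yes odd = trans (cong length (filter-accept (oddSum? c) {xs = []} odd))
                      (sym (trans (cong (_% 2) (sym (+-identityʳ c))) odd))
... | no ¬odd = trans (cong length (filter-reject (oddSum? c) {xs = []} ¬odd))
                      (sym (trans (cong (_% 2) (sym (+-identityʳ c))) (¬odd⇒even (c + 0) ¬odd)))

oddSumCount-∷ : ∀ c l L → oddSumCount c (l ∷ L) ≡ oddSumCount c L + oddSumCount (c + l) L
oddSumCount-∷ c l L = begin
  length (filter (oddSum? c) (sublists L ++ map (l ∷_) (sublists L)))
    ≡⟨ cong length (filter-++ (oddSum? c) (sublists L) _) ⟩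
  length (filter (oddSum? c) (sublists L) ++ filter (oddSum? c) (map (l ∷_) (sublists L)))
    ≡⟨ length-++ (filter (oddSum? c) (sublists L)) ⟩
  oddSumCount c L + length (filter (oddSum? c) (map (l ∷_) (sublists L)))
    ≡⟨ cong (λ X → oddSumCount c L + length X) (filter-map (oddSum? c) (l ∷_) (sublists L)) ⟩
  oddSumCount c L + length (map (l ∷_) (filter (oddSum? c ∘ (l ∷_)) (sublists L)))
    ≡⟨ cong (oddSumCount c L +_) (length-map (l ∷_) (filter (oddSum? c ∘ (l ∷_)) (sublists L))) ⟩
  oddSumCount c L + length (filter (oddSum? c ∘ (l ∷_)) (sublists L))
    ≡⟨ cong (λ X → oddSumCount c L + length X)
            (filter-≐ (oddSum? c ∘ (l ∷_)) (oddSum? (c + l)) ((λ {S} → reassoc {S}) , (λ {S} → reassoc⁻¹ {S})) (sublists L)) ⟩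
  oddSumCount c L + oddSumCount (c + l) L ∎
  where
  open ≡-Reasoning
  reassoc : ∀ {S} → IsOdd (c + (l + sum S)) → IsOdd (c + l + sum S)
  reassoc {S} = subst IsOdd (sym (+-assoc c l (sum S)))
  reassoc⁻¹ : ∀ {S} → IsOdd (c + l + sum S) → IsOdd (c + (l + sum S))
  reassoc⁻¹ {S} = subst IsOdd (+-assoc c l (sum S))

oddSumCount-all-even : ∀ L → ¬ Any IsOdd L → ∀ c → oddSumCount c L ≡ c % 2 * 2 ^ length L
oddSumCount-all-even []      _    c = trans (oddSumCount-[] c) (sym (*-identityʳ (c % 2)))
oddSumCount-all-even (l ∷ L) ¬odd c = begin
  oddSumCount c (l ∷ L)
    ≡⟨ oddSumCount-∷ c l L ⟩
  oddSumCount c L + oddSumCount (c + l) L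
    ≡⟨ cong₂ _+_ (oddSumCount-all-even L ¬odd′ c) (oddSumCount-all-even L ¬odd′ (c + l)) ⟩
  c % 2 * 2 ^ length L + (c + l) % 2 * 2 ^ length L
    ≡⟨ cong (λ x → c % 2 * 2 ^ length L + x * 2 ^ length L) (%2-+even c l (¬odd⇒even l (¬odd ∘ here))) ⟩
  c % 2 * 2 ^ length L + c % 2 * 2 ^ length L
    ≡⟨ solve 2 (λ x y → x :* y :+ x :* y := x :* (con 2 :* y)) refl (c % 2) (2 ^ length L) ⟩
  c % 2 * 2 ^ length (l ∷ L) ∎
  where
  open ≡-Reasoning
  ¬odd′ : ¬ Any IsOdd L
  ¬odd′ = ¬odd ∘ there

oddSumCount-some-odd : ∀ L → Any IsOdd L → ∀ c → oddSumCount c L ≡ 2 ^ (length L ∸ 1)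
oddSumCount-some-odd (l ∷ L) odd c with any? odd? L
... | yes oddL = begin
  oddSumCount c (l ∷ L)                        ≡⟨ oddSumCount-∷ c l L ⟩
  oddSumCount c L + oddSumCount (c + l) L
    ≡⟨ cong₂ _+_ (oddSumCount-some-odd L oddL c) (oddSumCount-some-odd L oddL (c + l)) ⟩
  2 ^ (length L ∸ 1) + 2 ^ (length L ∸ 1)      ≡⟨ solve 1 (λ x → x :+ x := con 2 :* x) refl (2 ^ (length L ∸ 1)) ⟩
  2 ^ suc (length L ∸ 1)                       ≡⟨ cong (2 ^_) (nonempty oddL) ⟩
  2 ^ length L                                 ∎
  where
  open ≡-Reasoning
  nonempty : ∀ {L} → Any IsOdd L → suc (length L ∸ 1) ≡ length L
  nonempty {_ ∷ _} _ = refl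
... | no ¬oddL = begin
  oddSumCount c (l ∷ L)                                ≡⟨ oddSumCount-∷ c l L ⟩
  oddSumCount c L + oddSumCount (c + l) L
    ≡⟨ cong₂ _+_ (oddSumCount-all-even L ¬oddL c) (oddSumCount-all-even L ¬oddL (c + l)) ⟩
  c % 2 * 2 ^ length L + (c + l) % 2 * 2 ^ length L   ≡⟨ *-distribʳ-+ (2 ^ length L) (c % 2) ((c + l) % 2) ⟨
  (c % 2 + (c + l) % 2) * 2 ^ length L                ≡⟨ cong (_* 2 ^ length L) (%2-+odd c l l-odd) ⟩
  1 * 2 ^ length L                                    ≡⟨ *-identityˡ _ ⟩
  2 ^ length L                                        ∎
  where
  open ≡-Reasoning
  l-odd : IsOdd l
  l-odd = head-odd odd
    where
    head-odd : Any IsOdd (l ∷ L) → IsOdd l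
    head-odd (here odd-l) = odd-l
    head-odd (there oddL) = ⊥-elim (¬oddL oddL)

module _ {n : ℕ} (ρ : Permutation′ n) where
  open Cycles ρ
  open FixedSubsets ρ

  fixedOddCount≡oddSumCount : ∀ {D} → Transversal D → fixedOddCount ρ ≡ oddSumCount 0 (map period D)
  fixedOddCount≡oddSumCount {D} tr = begin
    fixedOddCount ρ                                          ≡⟨ fixedOddCount≡length ⟩
    length fixedOddSubsets                                   ≡⟨ length-fixedOddSubsets tr ⟩
    length (filter oddPeriodSum? (sublists D))                     ≡⟨ length-map (map period) (filter oddPeriodSum? (sublists D)) ⟨
    length (map (map period) (filter oddPeriodSum? (sublists D)))  ≡⟨ cong length (filter-map (oddSum? 0) (map period) (sublists D)) ⟨
    length (filter (oddSum? 0) (map (map period) (sublists D)))  ≡⟨ cong (length ∘ filter (oddSum? 0)) (sublists-map period D) ⟨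
    oddSumCount 0 (map period D)                             ∎
    where open ≡-Reasoning

  2*fixedOddCount≡2^length : ∀ {D} → Transversal D → Any IsOdd (map period D) → 2 * fixedOddCount ρ ≡ 2 ^ length D
  2*fixedOddCount≡2^length {D} tr odd = begin
    2 * fixedOddCount ρ                       ≡⟨ cong (2 *_) (fixedOddCount≡oddSumCount tr) ⟩
    2 * oddSumCount 0 (map period D)          ≡⟨ cong (2 *_) (oddSumCount-some-odd (map period D) odd 0) ⟩
    2 * 2 ^ (length (map period D) ∸ 1)       ≡⟨ nonempty odd ⟩
    2 ^ length D                              ∎
    where
    open ≡-Reasoning
    nonempty : ∀ {D} → Any IsOdd (map period D) → 2 * 2 ^ (length (map period D) ∸ 1) ≡ 2 ^ length D
    nonempty {_ ∷ D} _ = cong (λ m → 2 * 2 ^ m) (length-map period D)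

  fixedOddCount≡0 : ∀ {D} → Transversal D → ¬ Any IsOdd (map period D) → fixedOddCount ρ ≡ 0
  fixedOddCount≡0 {D} tr ¬odd = trans (fixedOddCount≡oddSumCount tr) (oddSumCount-all-even (map period D) ¬odd 0)

gcd≢0ˡ : ∀ l k → .{{NonZero l}} → NonZero (gcd l k)
gcd≢0ˡ l k = ≢-nonZero (gcd[m,n]≢0 l k (inj₁ (≢-nonZero⁻¹ l)))

powerCycleLength : ℕ → ℕ → ℕ
powerCycleLength zero      k = 0
powerCycleLength l@(suc _) k = (l / gcd l k) {{gcd≢0ˡ l k}}

powerCycleLength*gcd : ∀ l k .{{_ : NonZero l}} → powerCycleLength l k * gcd l k ≡ l
powerCycleLength*gcd l@(suc _) k = m/n*n≡m {{gcd≢0ˡ l k}} (gcd[m,n]∣m l k)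

powerCycleLength≢0 : ∀ l k .{{_ : NonZero l}} → NonZero (powerCycleLength l k)
powerCycleLength≢0 l k = ≢-nonZero λ q≡0 → ≢-nonZero⁻¹ l (trans (sym (powerCycleLength*gcd l k)) (cong (_* gcd l k) q≡0))

powerCycleLength∣ : ∀ l k .{{_ : NonZero l}} → powerCycleLength l k ∣ l
powerCycleLength∣ l k = divides (gcd l k) (trans (sym (powerCycleLength*gcd l k)) (*-comm _ (gcd l k)))

powerCycleLength∣⇒∣* : ∀ l k m .{{_ : NonZero l}} → powerCycleLength l k ∣ m → l ∣ m * k
powerCycleLength∣⇒∣* l@(suc _) k m q∣m =
  ∣-trans (m/n∣o⇒m∣o*n {{gcd≢0ˡ l k}} (gcd[m,n]∣m l k) q∣m) (*-monoʳ-∣ m (gcd[m,n]∣n l k))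

∣*⇒powerCycleLength∣ : ∀ l k m .{{_ : NonZero l}} → l ∣ m * k → powerCycleLength l k ∣ m
∣*⇒powerCycleLength∣ l@(suc _) k m l∣mk =
  coprime-divisor (coprime-/gcd l k) (subst (q ∣_) (*-comm m (k / g)) q∣mk′)
  where
  g q : ℕ
  g = gcd l k
  q = powerCycleLength l k
  instance
    g≢0 : NonZero g
    g≢0 = gcd≢0ˡ l k
  q∣mk′ : q ∣ m * (k / g)
  q∣mk′ = *-cancelʳ-∣ g (subst₂ _∣_ (sym (powerCycleLength*gcd l k))
            (sym (trans (*-assoc m (k / g) g) (cong (m *_) (m/n*n≡m (gcd[m,n]∣n l k))))) l∣mk)

*[/powerCycleLength] : ∀ l k N .{{_ : NonZero l}} → powerCycleLength l k ∣ N →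
                       l * (N / powerCycleLength l k) {{powerCycleLength≢0 l k}} ≡ gcd l k * N
*[/powerCycleLength] l k N q∣N = begin
  l * (N / q)        ≡⟨ cong (_* (N / q)) (trans (sym (powerCycleLength*gcd l k)) (*-comm q g)) ⟩
  g * q * (N / q)    ≡⟨ *-assoc g q (N / q) ⟩
  g * (q * (N / q))  ≡⟨ cong (g *_) (m*[n/m]≡n q∣N) ⟩
  g * N              ∎
  where
  open ≡-Reasoning
  g q : ℕ
  g = gcd l k
  q = powerCycleLength l k
  instance
    q≢0 : NonZero q
    q≢0 = powerCycleLength≢0 l k

module Powers {n : ℕ} (π : Permutation′ n) (k : ℕ) where
  module P = Cycles π
  module Q = Cycles (π ^ₚ k)

  iter-^ₚ : ∀ m x → Q.iter m x ≡ P.iter (m * k) x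
  iter-^ₚ zero    x = refl
  iter-^ₚ (suc m) x = trans (cong (P.iter k) (iter-^ₚ m x)) (sym (P.iter-+ k (m * k) x))

  period-^ₚ : ∀ x → Q.period x ≡ powerCycleLength (P.period x) k
  period-^ₚ x = ∣-antisym
    (Q.iter≡⇒period∣ x q
      (trans (iter-^ₚ q x) (P.period∣⇒iter≡ x (q * k) (powerCycleLength∣⇒∣* (P.period x) k q ∣-refl))))
    (∣*⇒powerCycleLength∣ (P.period x) k (Q.period x)
      (P.iter≡⇒period∣ x (Q.period x * k) (trans (sym (iter-^ₚ (Q.period x) x)) (Q.iter-period x))))
    where q = powerCycleLength (P.period x) k

  period-^ₚ-iter : ∀ j x → Q.period (P.iter j x) ≡ Q.period x
  period-^ₚ-iter j x = trans (period-^ₚ (P.iter j x))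
    (trans (cong (λ l → powerCycleLength l k) (P.period-iter j x)) (sym (period-^ₚ x)))

  module _ {D D′ : List (Fin n)} (trP : P.Transversal D) (trQ : Q.Transversal D′) where

    private
      N : ℕ
      N = product (map P.period D)

      instance
        N≢0 : NonZero N
        N≢0 = product≢0 {ns = map P.period D} (All.tabulate λ l∈ →
          let x , _ , l≡ = ∈-map⁻ P.period {xs = D} l∈ in subst NonZero (sym l≡) P.period≢0)

      Qperiod∣N : ∀ z → Q.period z ∣ N
      Qperiod∣N z with x , x∈ , j , refl ← P.∈orbits⁻ {D} (P.Transversal.covers trP z) =
        subst (_∣ N) (sym (period-^ₚ (P.iter j x)))
          (∣-trans (powerCycleLength∣ (P.period (P.iter j x)) k)
                   (subst (_∣ N) (sym (P.period-iter j x)) (∈⇒∣product (∈-map⁺ P.period x∈))))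

      weight : Fin n → ℕ
      weight z = N / Q.period z

    -- Double counting: with weight N / (length of its π ^ k-cycle) at each point, every
    -- π ^ k-cycle weighs N and every π-cycle of length l weighs gcd l k * N.
    cycleCount-^ₚ : length D′ ≡ sum (map (λ x → gcd (P.period x) k) D)
    cycleCount-^ₚ = *-cancelʳ-≡ (length D′) _ N (begin
      length D′ * N                                      ≡⟨ sum-map-const N D′ ⟨
      sum (map (λ _ → N) D′)                             ≡⟨ sum-map-cong-local _ _ D′ (λ {y} _ → Qorbit-weight y) ⟨
      sum (map (λ y → sum (map weight (Q.orbit y))) D′)  ≡⟨ Q.sum-transversal trQ weight ⟩
      sum (map weight (allFin n))                        ≡⟨ P.sum-transversal trP weight ⟨
      sum (map (λ x → sum (map weight (P.orbit x))) D)   ≡⟨ sum-map-cong-local _ _ D (λ {x} _ → Porbit-weight x) ⟩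
      sum (map (λ x → gcd (P.period x) k * N) D)         ≡⟨ sum-map-*ʳ (λ x → gcd (P.period x) k) N D ⟩
      sum (map (λ x → gcd (P.period x) k) D) * N         ∎)
      where
      open ≡-Reasoning
      Qorbit-weight : ∀ y → sum (map weight (Q.orbit y)) ≡ N
      Qorbit-weight y = trans (Q.sum-orbit-invariant weight y (λ j → /-congʳ (Q.period-iter j y))) (m*[n/m]≡n (Qperiod∣N y))
      Porbit-weight : ∀ x → sum (map weight (P.orbit x)) ≡ gcd (P.period x) k * N
      Porbit-weight x = trans (P.sum-orbit-invariant weight x (λ j → /-congʳ (period-^ₚ-iter j x)))
        (trans (cong (P.period x *_) (/-congʳ {{_}} {{powerCycleLength≢0 (P.period x) k}} (period-^ₚ x)))
               (*[/powerCycleLength] (P.period x) k N (subst (_∣ N) (period-^ₚ x) (Qperiod∣N x))))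

    oddCycle-^ₚ : Any IsOdd (map Q.period D′) ⇔ Any (λ l → IsOdd (powerCycleLength l k)) (map P.period D)
    oddCycle-^ₚ = mk⇔ to from
      where
      to : Any IsOdd (map Q.period D′) → Any (λ l → IsOdd (powerCycleLength l k)) (map P.period D)
      to odd with y , _ , y-odd ← find (Any.map⁻ odd)
             with x , x∈ , j , refl ← P.∈orbits⁻ {D} (P.Transversal.covers trP y) =
        Any.map⁺ (lose x∈ (subst IsOdd (trans (period-^ₚ-iter j x) (period-^ₚ x)) y-odd))
      from : Any (λ l → IsOdd (powerCycleLength l k)) (map P.period D) → Any IsOdd (map Q.period D′)
      from odd with x , _ , x-odd ← find (Any.map⁻ odd)
               with y , y∈ , j , refl ← Q.∈orbits⁻ {D′} (Q.Transversal.covers trQ x) =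
        Any.map⁺ (lose y∈ (subst IsOdd (trans (sym (period-^ₚ (Q.iter j y))) (Q.period-iter j y)) x-odd))

totient : ℕ → ℕ
totient d = ∑[ j < d ] ⟦ gcd j d ≟ 1 ⟧

totient≥1 : ∀ d → .{{NonZero d}} → 1 ≤ totient d
totient≥1 (suc zero)    = sumBelow-positive 1 (λ j → gcd j 1 ≟ 1) 0 (s≤s z≤n) refl
totient≥1 (suc (suc d)) = sumBelow-positive (suc (suc d)) (λ j → gcd j (suc (suc d)) ≟ 1) 1 (s≤s (s≤s z≤n))
                            (gcd-zeroˡ (suc (suc d)))

-- Cut j < g = E * d into d blocks of length E: in block a only j = a * E can satisfy
-- the condition, and it does exactly when gcd a d ≡ 1.
gcd-fibre-count : ∀ g d → .{{NonZero g}} → ∑[ j < g ] ⟦ gcd j g * d ≟ g ⟧ ≡ ⟦ d ∣? g ⟧ * totient d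
gcd-fibre-count g d with d ∣? g
... | no d∤g = sumBelow-zero g (λ j _ → cong boolToℕ (dec-false (gcd j g * d ≟ g) (λ e → d∤g (divides (gcd j g) (sym e)))))
... | yes (divides zero g≡0) = ⊥-elim (≢-nonZero⁻¹ g g≡0)
... | yes (divides (suc e) g≡Ed) = begin
  ∑[ j < g ] F j                        ≡⟨ cong (λ x → sumBelow x F) (trans g≡Ed (*-comm E d)) ⟩
  ∑[ j < d * E ] F j                    ≡⟨ sumBelow-blocks d E F ⟩
  ∑[ a < d ] ∑[ r < E ] F (a * E + r)   ≡⟨ sumBelow-cong d (λ a _ → block a) ⟩
  totient d                             ≡⟨ +-identityʳ (totient d) ⟨
  1 * totient d                         ∎
  where
  open ≡-Reasoning
  E : ℕ
  E = suc e
  F : ℕ → ℕ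
  F j = ⟦ gcd j g * d ≟ g ⟧
  instance
    d≢0 : NonZero d
    d≢0 = ≢-nonZero λ d≡0 → ≢-nonZero⁻¹ g (trans g≡Ed (trans (cong (E *_) d≡0) (*-zeroʳ E)))
  gcd[aE,g] : ∀ a → gcd (a * E) g ≡ E * gcd a d
  gcd[aE,g] a = trans (cong₂ gcd (*-comm a E) g≡Ed) (sym (c*gcd[m,n]≡gcd[cm,cn] E a d))
  block : ∀ a → ∑[ r < E ] F (a * E + r) ≡ ⟦ gcd a d ≟ 1 ⟧
  block a = trans (cong₂ _+_ first (sumBelow-zero e rest)) (+-identityʳ _)
    where
    gcd[aE+0,g] : gcd (a * E + 0) g ≡ E * gcd a d
    gcd[aE+0,g] = trans (cong (λ x → gcd x g) (+-identityʳ (a * E))) (gcd[aE,g] a)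
    first : F (a * E + 0) ≡ ⟦ gcd a d ≟ 1 ⟧
    first = cong boolToℕ (does-⇔ (mk⇔ to from) (gcd (a * E + 0) g * d ≟ g) (gcd a d ≟ 1))
      where
      to : gcd (a * E + 0) g * d ≡ g → gcd a d ≡ 1
      to eq = *-cancelˡ-≡ (gcd a d) 1 E (*-cancelʳ-≡ (E * gcd a d) (E * 1) d
                (trans (cong (_* d) (sym gcd[aE+0,g])) (trans eq (trans g≡Ed (cong (_* d) (sym (*-identityʳ E)))))))
      from : gcd a d ≡ 1 → gcd (a * E + 0) g * d ≡ g
      from eq = trans (cong (_* d) (trans gcd[aE+0,g] (trans (cong (E *_) eq) (*-identityʳ E)))) (sym g≡Ed)
    rest : ∀ r → r < e → F (a * E + suc r) ≡ 0
    rest r r<e = cong boolToℕ (dec-false (gcd (a * E + suc r) g * d ≟ g) impossible)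
      where
      impossible : ¬ (gcd (a * E + suc r) g * d ≡ g)
      impossible eq = <⇒≱ (s≤s r<e) (∣⇒≤ E∣1+r)
        where
        gcd≡E : gcd (a * E + suc r) g ≡ E
        gcd≡E = *-cancelʳ-≡ _ E d (trans eq g≡Ed)
        E∣1+r : E ∣ suc r
        E∣1+r = ∣m+n∣m⇒∣n (subst (_∣ a * E + suc r) gcd≡E (gcd[m,n]∣m (a * E + suc r) g)) (n∣m*n a)

gcd-fibre-unique : ∀ g B j → .{{NonZero g}} → g ≤ B → ∑[ i < B ] ⟦ gcd j g * suc i ≟ g ⟧ ≡ 1
gcd-fibre-unique g B j g≤B with gcd[m,n]∣n j g
... | divides zero     g≡0      = ⊥-elim (≢-nonZero⁻¹ g g≡0)
... | divides (suc i₀) g≡i₀+1*c =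
  sumBelow-single B (λ i → c * suc i ≟ g) i₀ i₀<B
    (trans (*-comm c (suc i₀)) (sym g≡i₀+1*c))
    (λ i _ eq → suc-injective (*-cancelˡ-≡ (suc i) (suc i₀) c
                  (trans eq (trans g≡i₀+1*c (*-comm (suc i₀) c)))))
  where
  c : ℕ
  c = gcd j g
  instance
    c≢0 : NonZero c
    c≢0 = ≢-nonZero (gcd[m,n]≢0 j g (inj₂ (≢-nonZero⁻¹ g)))
  i₀<B : i₀ < B
  i₀<B = ≤-trans (subst (suc i₀ ≤_) (sym g≡i₀+1*c) (m≤m*n (suc i₀) c)) g≤B

totient-divisor-sum : ∀ g B → .{{NonZero g}} → g ≤ B → ∑[ i < B ] (⟦ suc i ∣? g ⟧ * totient (suc i)) ≡ g
totient-divisor-sum g B g≤B = begin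
  ∑[ i < B ] (⟦ suc i ∣? g ⟧ * totient (suc i))      ≡⟨ sumBelow-cong B (λ i _ → gcd-fibre-count g (suc i)) ⟨
  ∑[ i < B ] ∑[ j < g ] ⟦ gcd j g * suc i ≟ g ⟧    ≡⟨ sumBelow-comm B g _ ⟩
  ∑[ j < g ] ∑[ i < B ] ⟦ gcd j g * suc i ≟ g ⟧    ≡⟨ sumBelow-cong g (λ j _ → gcd-fibre-unique g B j g≤B) ⟩
  ∑[ j < g ] 1                                     ≡⟨ sumBelow-one g ⟩
  g                                                ∎
  where open ≡-Reasoning

gcd≡sumBelow : ∀ l m B → .{{NonZero l}} → l ≤ B →
               gcd l m ≡ ∑[ i < B ] (⟦ suc i ∣? m ⟧ * totient (suc i) * ⟦ suc i ∣? l ⟧)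
gcd≡sumBelow l m B l≤B =
  trans (sym (totient-divisor-sum (gcd l m) B {{gcd≢0ˡ l m}} (≤-trans (∣⇒≤ (gcd[m,n]∣m l m)) l≤B)))
        (sumBelow-cong B (λ i _ → trans (cong (_* totient (suc i)) (∣gcd-indicator (suc i)))
                                        (reorder ⟦ suc i ∣? m ⟧ ⟦ suc i ∣? l ⟧ (totient (suc i)))))
  where
  reorder : ∀ a b c → a * b * c ≡ a * c * b
  reorder a b c = trans (*-assoc a b c) (trans (cong (a *_) (*-comm b c)) (sym (*-assoc a c b)))
  ∣gcd-indicator : ∀ d → ⟦ d ∣? gcd l m ⟧ ≡ ⟦ d ∣? m ⟧ * ⟦ d ∣? l ⟧
  ∣gcd-indicator d with d ∣? gcd l m | d ∣? l | d ∣? m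
  ... | yes _  | yes _   | yes _   = refl
  ... | no _   | no _    | no _    = refl
  ... | no _   | no _    | yes _   = refl
  ... | no _   | yes _   | no _    = refl
  ... | no d∤g | yes d∣l | yes d∣m = ⊥-elim (d∤g (gcd-greatest d∣l d∣m))
  ... | yes d∣g | no d∤l | _       = ⊥-elim (d∤l (∣-trans d∣g (gcd[m,n]∣m l m)))
  ... | yes d∣g | yes _  | no d∤m  = ⊥-elim (d∤m (∣-trans d∣g (gcd[m,n]∣n l m)))

cycleCount : List ℕ → ℕ → ℕ
cycleCount L m = sum (map (λ l → gcd l m) L)

multiples : ℕ → List ℕ → ℕ
multiples d L = sum (map (λ l → ⟦ d ∣? l ⟧) L)

InRange : ℕ → List ℕ → Set
InRange B = All (λ l → 1 ≤ l × l ≤ B)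

cycleCount≡sumBelow : ∀ B L m → InRange B L →
  cycleCount L m ≡ ∑[ i < B ] (⟦ suc i ∣? m ⟧ * totient (suc i) * multiples (suc i) L)
cycleCount≡sumBelow B L m inRange = begin
  sum (map (λ l → gcd l m) L)
    ≡⟨ sum-map-cong-local _ _ L (λ l∈ → let 1≤l , l≤B = All.lookup inRange l∈
                                       in gcd≡sumBelow _ m B {{>-nonZero 1≤l}} l≤B) ⟩
  sum (map (λ l → ∑[ i < B ] (c i * ⟦ suc i ∣? l ⟧)) L)
    ≡⟨ sum-map-sumBelow L B (λ l i → c i * ⟦ suc i ∣? l ⟧) ⟩
  ∑[ i < B ] sum (map (λ l → c i * ⟦ suc i ∣? l ⟧) L)
    ≡⟨ sumBelow-cong B (λ i _ → sum-map-*ˡ (c i) (λ l → ⟦ suc i ∣? l ⟧) L) ⟩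
  ∑[ i < B ] (c i * multiples (suc i) L) ∎
  where
  open ≡-Reasoning
  c : ℕ → ℕ
  c i = ⟦ suc i ∣? m ⟧ * totient (suc i)

multiples-determined : ∀ B L M → InRange B L → InRange B M → (∀ m → 1 ≤ m → cycleCount L m ≡ cycleCount M m) →
                       ∀ d → 1 ≤ d → d ≤ B → multiples d L ≡ multiples d M
multiples-determined B L M rL rM same = <-rec P step
  where
  P : ℕ → Set
  P d = 1 ≤ d → d ≤ B → multiples d L ≡ multiples d M
  step : ∀ d → (∀ {d′} → d′ < d → P d′) → P d
  step d@(suc i₀) below _ d≤B = *-cancelˡ-≡ _ _ (totient d) {{>-nonZero (totient≥1 d)}}
    (trans (sym (leading L)) (trans (sumBelow-point B F G i₀ d≤B others total) (leading M)))
    where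
    c : ℕ → ℕ
    c i = ⟦ suc i ∣? d ⟧ * totient (suc i)
    F G : ℕ → ℕ
    F i = c i * multiples (suc i) L
    G i = c i * multiples (suc i) M
    total : ∑[ i < B ] F i ≡ ∑[ i < B ] G i
    total = trans (sym (cycleCount≡sumBelow B L d rL)) (trans (same d (s≤s z≤n)) (cycleCount≡sumBelow B M d rM))
    others : ∀ i → i < B → i ≢ i₀ → F i ≡ G i
    others i i<B i≢i₀ with suc i ∣? d
    ... | yes i+1∣d rewrite dec-true (suc i ∣? d) i+1∣d =
      cong ((totient (suc i) + 0) *_) (below (≤∧≢⇒< (∣⇒≤ i+1∣d) (i≢i₀ ∘ suc-injective)) (s≤s z≤n) i<B)
    ... | no i+1∤d  rewrite dec-false (suc i ∣? d) i+1∤d = refl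
    leading : ∀ X → c i₀ * multiples d X ≡ totient d * multiples d X
    leading X rewrite dec-true (d ∣? d) ∣-refl = cong (_* multiples d X) (+-identityʳ (totient d))

sum-⟦⟧≡length-filter : ∀ {A : Set} {P : A → Set} (P? : Decidable P) xs →
                       sum (map (λ x → ⟦ P? x ⟧) xs) ≡ length (filter P? xs)
sum-⟦⟧≡length-filter P? []       = refl
sum-⟦⟧≡length-filter P? (x ∷ xs) with P? x
... | yes _ = cong suc (sum-⟦⟧≡length-filter P? xs)
... | no _  = sum-⟦⟧≡length-filter P? xs

multiples-↭ : ∀ d {xs ys} → xs ↭ ys → multiples d xs ≡ multiples d ys
multiples-↭ d p = sum-↭ (↭.map⁺ (λ l → ⟦ d ∣? l ⟧) p)

multiples-++ : ∀ d xs ys → multiples d (xs ++ ys) ≡ multiples d xs + multiples d ys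
multiples-++ d = sum-map-++ (λ l → ⟦ d ∣? l ⟧)

multiples-injective : ∀ B L M → InRange B L → InRange B M →
                      (∀ d → 1 ≤ d → d ≤ B → multiples d L ≡ multiples d M) → L ↭ M
multiples-injective zero    []      []      _ _ _ = ↭-refl
multiples-injective zero    (l ∷ L) _       ((1≤l , l≤0) ∷ _) _ _ = ⊥-elim (<⇒≱ 1≤l l≤0)
multiples-injective zero    []      (l ∷ M) _ ((1≤l , l≤0) ∷ _) _ = ⊥-elim (<⇒≱ 1≤l l≤0)
multiples-injective (suc B) L M rL rM same = begin
  L                   ↭⟨ partition-↭ top? L ⟩
  top L ++ rest L     ≡⟨ cong (_++ rest L) top-same ⟩
  top M ++ rest L     ↭⟨ ↭.++⁺ˡ (top M) (multiples-injective B (rest L) (rest M) (rest-inRange rL) (rest-inRange rM) rest-same) ⟩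
  top M ++ rest M     ↭⟨ partition-↭ top? M ⟨
  M                   ∎
  where
  open PermutationReasoning
  top? : ∀ l → Dec (l ≡ suc B)
  top? l = l ≟ suc B
  top rest : List ℕ → List ℕ
  top  = filter top?
  rest = filter (¬? ∘ top?)
  multiples-top : ∀ X → InRange (suc B) X → multiples (suc B) X ≡ length (top X)
  multiples-top X inRange = trans
    (sum-map-cong-local _ _ X (λ l∈ → let 1≤l , l≤ = All.lookup inRange l∈ in
      cong boolToℕ (does-⇔ (mk⇔ (λ B+1∣l → ≤-antisym l≤ (∣⇒≤ {{>-nonZero 1≤l}} B+1∣l)) (λ { refl → ∣-refl }))
                           (suc B ∣? _) (_ ≟ suc B))))
    (sum-⟦⟧≡length-filter top? X)
  top-replicate : ∀ X → top X ≡ replicate (length (top X)) (suc B)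
  top-replicate X = all≡⇒replicate (suc B) (top X) (λ l∈ → proj₂ (∈-filter⁻ top? {xs = X} l∈))
  top-same : top L ≡ top M
  top-same = trans (top-replicate L) (trans (cong (λ k → replicate k (suc B)) lengths) (sym (top-replicate M)))
    where
    lengths : length (top L) ≡ length (top M)
    lengths = trans (sym (multiples-top L rL)) (trans (same (suc B) (s≤s z≤n) ≤-refl) (multiples-top M rM))
  split : ∀ d X → multiples d X ≡ multiples d (top X) + multiples d (rest X)
  split d X = trans (multiples-↭ d (partition-↭ top? X)) (multiples-++ d (top X) (rest X))
  rest-same : ∀ d → 1 ≤ d → d ≤ B → multiples d (rest L) ≡ multiples d (rest M)
  rest-same d 1≤d d≤B = +-cancelˡ-≡ (multiples d (top L)) _ _
    (trans (sym (split d L)) (trans (same d 1≤d (m≤n⇒m≤1+n d≤B))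
      (trans (split d M) (cong (λ X → multiples d X + multiples d (rest M)) (sym top-same)))))
  rest-inRange : ∀ {X} → InRange (suc B) X → InRange B (rest X)
  rest-inRange {X} inRange = All.tabulate λ l∈ →
    let l∈X , l≢ = ∈-filter⁻ (¬? ∘ top?) {xs = X} l∈
        1≤l , l≤ = All.lookup inRange l∈X
    in 1≤l , ≤-pred (≤∧≢⇒< l≤ l≢)

inRange-sum : ∀ B L → All (1 ≤_) L → sum L ≤ B → InRange B L
inRange-sum B []      []       _   = []
inRange-sum B (l ∷ L) (1≤l ∷ ps) s≤B =
  (1≤l , ≤-trans (m≤m+n l (sum L)) s≤B) ∷ inRange-sum B L ps (≤-trans (m≤n+m (sum L) l) s≤B)

cycleCount-injective : ∀ L M → All (1 ≤_) L → All (1 ≤_) M →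
                       (∀ m → 1 ≤ m → cycleCount L m ≡ cycleCount M m) → L ↭ M
cycleCount-injective L M posL posM same =
  multiples-injective bound L M inL inM (multiples-determined bound L M inL inM same)
  where
  bound : ℕ
  bound = sum L + sum M
  inL : InRange bound L
  inL = inRange-sum bound L posL (m≤m+n (sum L) (sum M))
  inM : InRange bound M
  inM = inRange-sum bound M posM (m≤n+m (sum M) (sum L))

odd⇒coprime-2 : ∀ {r} → IsOdd r → Coprime r 2
odd⇒coprime-2 {r} odd {i} (i∣r , i∣2) with i
... | 0                 = ⊥-elim (0≢1+n (sym (0∣⇒≡0 i∣2)))
... | 1                 = refl
... | 2                 = ⊥-elim (odd⇒∤2 odd i∣r)
... | suc (suc (suc _)) = ⊥-elim (<⇒≱ (s≤s (s≤s (s≤s z≤n))) (∣⇒≤ i∣2))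

odd∣2^⇒≡1 : ∀ a {r} → r ∣ 2 ^ a → IsOdd r → r ≡ 1
odd∣2^⇒≡1 zero    r∣1   _   = ∣1⇒≡1 r∣1
odd∣2^⇒≡1 (suc a) r∣2^a+1 odd = odd∣2^⇒≡1 a (coprime-divisor (odd⇒coprime-2 odd) r∣2^a+1) odd

n<2^n : ∀ n → n < 2 ^ n
n<2^n zero    = s≤s z≤n
n<2^n (suc n) = ≤-trans (s≤s (n<2^n n))
  (subst₂ _≤_ (+-comm (2 ^ n) 1) (cong (2 ^ n +_) (sym (+-identityʳ (2 ^ n)))) (+-monoʳ-≤ (2 ^ n) (m^n>0 2 n)))

even-powerCycleLength : ∀ l a .{{_ : NonZero l}} → ¬ IsOdd (powerCycleLength l (2 ^ a)) → 2 ^ suc a ∣ l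
even-powerCycleLength l@(suc _) a even = subst (2 ^ suc a ∣_) l≡q*2^a (*-monoˡ-∣ (2 ^ a) 2∣q)
  where
  g q r : ℕ
  g = gcd l (2 ^ a)
  q = powerCycleLength l (2 ^ a)
  instance
    g≢0 : NonZero g
    g≢0 = gcd≢0ˡ l (2 ^ a)
  r = 2 ^ a / g
  2∣q : 2 ∣ q
  2∣q = ¬odd⇒2∣ even
  r-odd : IsOdd r
  r-odd = ∤2⇒odd (λ 2∣r → contradiction (coprime-/gcd l (2 ^ a) (2∣q , 2∣r)))
    where
    contradiction : 2 ≢ 1
    contradiction ()
  2^a≡r*g : 2 ^ a ≡ r * g
  2^a≡r*g = sym (m/n*n≡m (gcd[m,n]∣n l (2 ^ a)))
  g≡2^a : g ≡ 2 ^ a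
  g≡2^a = sym (trans 2^a≡r*g (trans (cong (_* g) (odd∣2^⇒≡1 a (divides g (trans 2^a≡r*g (*-comm r g))) r-odd)) (*-identityˡ g)))
  l≡q*2^a : q * 2 ^ a ≡ l
  l≡q*2^a = trans (cong (q *_) (sym g≡2^a)) (powerCycleLength*gcd l (2 ^ a))

powerCycleLength-∣ : ∀ l {a b} .{{_ : NonZero l}} → a ∣ b → powerCycleLength l b ∣ powerCycleLength l a
powerCycleLength-∣ l {a} {b} a∣b = ∣*⇒powerCycleLength∣ l b (powerCycleLength l a)
  (∣-trans (powerCycleLength∣⇒∣* l a (powerCycleLength l a) ∣-refl) (*-monoʳ-∣ (powerCycleLength l a) a∣b))

odd-powerCycleLength-2^ : ∀ l .{{_ : NonZero l}} → IsOdd (powerCycleLength l (2 ^ l))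
odd-powerCycleLength-2^ l with odd? (powerCycleLength l (2 ^ l))
... | yes odd  = odd
... | no ¬odd  = ⊥-elim (<⇒≱ (≤-trans (n<2^n l) (m≤m+n (2 ^ l) _)) (∣⇒≤ (even-powerCycleLength l l ¬odd)))

HasOddPowerCycle : ℕ → List ℕ → Set
HasOddPowerCycle k = Any (λ l → IsOdd (powerCycleLength l k))

hasOddPowerCycle? : ∀ k L → Dec (HasOddPowerCycle k L)
hasOddPowerCycle? k = any? (λ l → odd? (powerCycleLength l k))

hasOddPowerCycle-2^ : ∀ {l L} → All (1 ≤_) L → l ∈ L → HasOddPowerCycle (2 ^ l) L
hasOddPowerCycle-2^ {l} pos l∈ = lose l∈ (odd-powerCycleLength-2^ l {{>-nonZero (All.lookup pos l∈)}})

all-divisible : ∀ e X → All (1 ≤_) X → (∀ a → a < e → ¬ HasOddPowerCycle (2 ^ a) X) → All (2 ^ e ∣_) X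
all-divisible zero    X pos noOdd = All.tabulate λ {l} _ → 1∣ l
all-divisible (suc e) X pos noOdd = All.tabulate λ {l} l∈ →
  even-powerCycleLength l e {{>-nonZero (All.lookup pos l∈)}} (λ odd → noOdd e ≤-refl (lose l∈ odd))

module _ (e : ℕ) where
  private
    instance
      2^e≢0 : NonZero (2 ^ e)
      2^e≢0 = m^n≢0 2 e

  halve : ℕ → ℕ
  halve l = l / 2 ^ e

  hasOddPowerCycle-* : ∀ X → All (1 ≤_) X → HasOddPowerCycle (2 ^ e) X → ∀ m → HasOddPowerCycle (2 ^ e * m) X
  hasOddPowerCycle-* X pos odd m with l , l∈ , l-odd ← find odd =
    lose l∈ (odd-∣ (powerCycleLength-∣ l {{>-nonZero (All.lookup pos l∈)}} (m∣m*n m)) l-odd)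

  cycleCount-halve : ∀ X → All (2 ^ e ∣_) X → ∀ m → cycleCount X (2 ^ e * m) ≡ 2 ^ e * cycleCount (map halve X) m
  cycleCount-halve []      []           m = sym (*-zeroʳ (2 ^ e))
  cycleCount-halve (l ∷ X) (2^e∣l ∷ div) m = begin
    gcd l (2 ^ e * m) + cycleCount X (2 ^ e * m)                  ≡⟨ cong₂ _+_ gcd-halve (cycleCount-halve X div m) ⟩
    2 ^ e * gcd (halve l) m + 2 ^ e * cycleCount (map halve X) m  ≡⟨ *-distribˡ-+ (2 ^ e) _ _ ⟨
    2 ^ e * cycleCount (map halve (l ∷ X)) m                       ∎
    where
    open ≡-Reasoning
    gcd-halve : gcd l (2 ^ e * m) ≡ 2 ^ e * gcd (halve l) m
    gcd-halve = trans (cong (λ x → gcd x (2 ^ e * m)) (trans (sym (m/n*n≡m 2^e∣l)) (*-comm (halve l) (2 ^ e))))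
                      (sym (c*gcd[m,n]≡gcd[cm,cn] (2 ^ e) (halve l) m))

  halve-positive : ∀ {X} → All (1 ≤_) X → All (2 ^ e ∣_) X → All (1 ≤_) (map halve X)
  halve-positive []           []             = []
  halve-positive (1≤l ∷ pos) (2^e∣l ∷ div) = m≥n⇒m/n>0 (∣⇒≤ {{>-nonZero 1≤l}} 2^e∣l) ∷ halve-positive pos div

  double-halve : ∀ X → All (2 ^ e ∣_) X → map (_* 2 ^ e) (map halve X) ≡ X
  double-halve []      []            = refl
  double-halve (l ∷ X) (2^e∣l ∷ div) = cong₂ _∷_ (m/n*n≡m 2^e∣l) (double-halve X div)

cycleType-recovery : ∀ L M → All (1 ≤_) L → All (1 ≤_) M →
                     (∀ k → HasOddPowerCycle k L ⇔ HasOddPowerCycle k M) →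
                     (∀ k → HasOddPowerCycle k L → cycleCount L k ≡ cycleCount M k) → L ↭ M
cycleType-recovery []      []      _    _    _       _         = ↭-refl
cycleType-recovery []      (m ∷ M) _    posM sameOdd _
  with () ← Equivalence.from (sameOdd (2 ^ m)) (hasOddPowerCycle-2^ posM (here refl))
cycleType-recovery (l ∷ L) M       posL posM sameOdd sameCount =
  subst₂ _↭_ (double-halve e (l ∷ L) divL) (double-halve e M divM) (↭.map⁺ (_* 2 ^ e) halved)
  where
  -- As e is least, 2 ^ e divides every cycle length, and every (2 ^ e * m)-th power
  -- still has an odd cycle.
  least-e : ∃[ e ] HasOddPowerCycle (2 ^ e) (l ∷ L) × (∀ a → a < e → ¬ HasOddPowerCycle (2 ^ a) (l ∷ L))
  least-e = least (λ a → hasOddPowerCycle? (2 ^ a) (l ∷ L)) l (hasOddPowerCycle-2^ posL (here refl))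
  e : ℕ
  e = proj₁ least-e
  divL : All (2 ^ e ∣_) (l ∷ L)
  divL = all-divisible e (l ∷ L) posL (proj₂ (proj₂ least-e))
  divM : All (2 ^ e ∣_) M
  divM = all-divisible e M posM (λ a a<e odd → proj₂ (proj₂ least-e) a a<e (Equivalence.from (sameOdd (2 ^ a)) odd))
  halved : map (halve e) (l ∷ L) ↭ map (halve e) M
  halved = cycleCount-injective _ _ (halve-positive e posL divL) (halve-positive e posM divM) λ m _ →
    *-cancelˡ-≡ _ _ (2 ^ e) {{m^n≢0 2 e}} (begin
      2 ^ e * cycleCount (map (halve e) (l ∷ L)) m  ≡⟨ cycleCount-halve e (l ∷ L) divL m ⟨
      cycleCount (l ∷ L) (2 ^ e * m)                ≡⟨ sameCount (2 ^ e * m) (hasOddPowerCycle-* e (l ∷ L) posL (proj₁ (proj₂ least-e)) m) ⟩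
      cycleCount M (2 ^ e * m)                      ≡⟨ cycleCount-halve e M divM m ⟩
      2 ^ e * cycleCount (map (halve e) M) m        ∎)
    where open ≡-Reasoning

cycleType : ∀ {n} → Permutation′ n → List ℕ
cycleType π = map period (proj₁ transversal)
  where open Cycles π

cycleType-positive : ∀ {n} (π : Permutation′ n) → All (1 ≤_) (cycleType π)
cycleType-positive π = All.tabulate λ l∈ → let x , _ , l≡ = ∈-map⁻ period l∈ in subst (1 ≤_) (sym l≡) (period>0 x)
  where open Cycles π

module _ {n : ℕ} (π : Permutation′ n) (k : ℕ) where
  private
    module P = Cycles π
    module Q = Cycles (π ^ₚ k)
    trP : P.Transversal (proj₁ P.transversal)
    trP = proj₂ P.transversal
    trQ : Q.Transversal (proj₁ Q.transversal)
    trQ = proj₂ Q.transversal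

  cycleCount-cycleType : length (proj₁ Q.transversal) ≡ cycleCount (cycleType π) k
  cycleCount-cycleType = trans (Powers.cycleCount-^ₚ π k trP trQ) (cong sum (map-∘ (proj₁ P.transversal)))

  2*fixedOddCount-^ₚ : HasOddPowerCycle k (cycleType π) → 2 * fixedOddCount (π ^ₚ k) ≡ 2 ^ cycleCount (cycleType π) k
  2*fixedOddCount-^ₚ odd = trans (2*fixedOddCount≡2^length (π ^ₚ k) trQ (Equivalence.from (Powers.oddCycle-^ₚ π k trP trQ) odd))
                               (cong (2 ^_) cycleCount-cycleType)

  fixedOddCount-^ₚ≡0 : ¬ HasOddPowerCycle k (cycleType π) → fixedOddCount (π ^ₚ k) ≡ 0
  fixedOddCount-^ₚ≡0 ¬odd = fixedOddCount≡0 (π ^ₚ k) trQ (¬odd ∘ Equivalence.to (Powers.oddCycle-^ₚ π k trP trQ))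

2^-injective : ∀ {a b} → 2 ^ a ≡ 2 ^ b → a ≡ b
2^-injective {a} {b} eq with <-cmp a b
... | tri< a<b _ _ = ⊥-elim (<-irrefl eq (^-monoʳ-< 2 (s≤s (s≤s z≤n)) a<b))
... | tri≈ _ a≡b _ = a≡b
... | tri> _ _ b<a = ⊥-elim (<-irrefl (sym eq) (^-monoʳ-< 2 (s≤s (s≤s z≤n)) b<a))

fixedOddCounts-determine-cycleType : ∀ {n} (π σ : Permutation′ n) →
  (∀ k → fixedOddCount (π ^ₚ k) ≡ fixedOddCount (σ ^ₚ k)) → cycleType π ↭ cycleType σ
fixedOddCounts-determine-cycleType π σ same =
  cycleType-recovery (cycleType π) (cycleType σ) (cycleType-positive π) (cycleType-positive σ)
    (λ k → mk⇔ (transfer π σ same k) (transfer σ π (sym ∘ same) k))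
    (λ k odd → 2^-injective (begin
      2 ^ cycleCount (cycleType π) k  ≡⟨ 2*fixedOddCount-^ₚ π k odd ⟨
      2 * fixedOddCount (π ^ₚ k)      ≡⟨ cong (2 *_) (same k) ⟩
      2 * fixedOddCount (σ ^ₚ k)      ≡⟨ 2*fixedOddCount-^ₚ σ k (transfer π σ same k odd) ⟩
      2 ^ cycleCount (cycleType σ) k  ∎))
  where
  open ≡-Reasoning
  transfer : ∀ {n} (π σ : Permutation′ n) → (∀ k → fixedOddCount (π ^ₚ k) ≡ fixedOddCount (σ ^ₚ k)) →
             ∀ k → HasOddPowerCycle k (cycleType π) → HasOddPowerCycle k (cycleType σ)
  transfer π σ same k odd with hasOddPowerCycle? k (cycleType σ)
  ... | yes oddσ = oddσ
  ... | no ¬oddσ = ⊥-elim (≢-nonZero⁻¹ (2 ^ c) {{m^n≢0 2 c}}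
    (trans (sym (2*fixedOddCount-^ₚ π k odd)) (trans (cong (2 *_) (same k)) (cong (2 *_) (fixedOddCount-^ₚ≡0 σ k ¬oddσ)))))
    where
    c : ℕ
    c = cycleCount (cycleType π) k

module Conjugacy {n : ℕ} (π σ : Permutation′ n) where
  module P = Cycles π
  module S = Cycles σ

  module _ (W : List (Fin n × Fin n)) (trP : P.Transversal (map proj₁ W)) (trS : S.Transversal (map proj₂ W))
           (sameLength : All (λ w → P.period (proj₁ w) ≡ S.period (proj₂ w)) W) where

    cycle : Fin n × Fin n → List (Fin n × Fin n)
    cycle (x , y) = applyUpTo (λ j → P.iter j x , S.iter j y) (P.period x)

    -- The graph of the conjugating permutation: the j-th point of the cycle of x is sent to
    -- the j-th point of the cycle of y, for each matched pair (x , y).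
    graph : List (Fin n × Fin n)
    graph = concatMap cycle W

    proj₁-graph : map proj₁ graph ≡ P.orbits (map proj₁ W)
    proj₁-graph = begin
      map proj₁ (concatMap cycle W)                         ≡⟨ map-concatMap proj₁ cycle W ⟩
      concatMap (map proj₁ ∘ cycle) W
        ≡⟨ cong List.concat (map-cong (λ w → map-applyUpTo _ proj₁ (P.period (proj₁ w))) W) ⟩
      concatMap (P.orbit ∘ proj₁) W                         ≡⟨ concatMap-map P.orbit proj₁ W ⟨
      P.orbits (map proj₁ W)                                ∎
      where open ≡-Reasoning

    proj₂-graph : map proj₂ graph ≡ S.orbits (map proj₂ W)
    proj₂-graph = begin
      map proj₂ (concatMap cycle W)   ≡⟨ map-concatMap proj₂ cycle W ⟩
      concatMap (map proj₂ ∘ cycle) W ≡⟨ cong List.concat (map-cong-local (All.map sameOrbit sameLength)) ⟩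
      concatMap (S.orbit ∘ proj₂) W   ≡⟨ concatMap-map S.orbit proj₂ W ⟨
      S.orbits (map proj₂ W)          ∎
      where
      open ≡-Reasoning
      sameOrbit : ∀ {w} → P.period (proj₁ w) ≡ S.period (proj₂ w) → map proj₂ (cycle w) ≡ S.orbit (proj₂ w)
      sameOrbit {x , y} eq = trans (map-applyUpTo _ proj₂ (P.period x)) (cong (applyUpTo (λ j → S.iter j y)) eq)

    graph-closed : ∀ {a b} → (a , b) ∈ graph → (π ⟨$⟩ʳ a , σ ⟨$⟩ʳ b) ∈ graph
    graph-closed ab∈ with w , w∈ , ab∈cycle ← find (∈-concatMap⁻ cycle {xs = W} ab∈)
                     with j , _ , refl ← ∈-applyUpTo⁻ (λ j → P.iter j (proj₁ w) , S.iter j (proj₂ w)) ab∈cycle =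
      ∈-concatMap⁺ cycle {xs = W} (Any.map (λ { refl → next }) w∈)
      where
      x y : Fin n
      x = proj₁ w
      y = proj₂ w
      next : (P.iter (suc j) x , S.iter (suc j) y) ∈ cycle w
      next = subst (_∈ cycle w) (cong₂ _,_ (sym (P.iter-%period x (suc j)))
                 (trans (cong (λ m → S.iter m y) (%-congʳ (All.lookup sameLength w∈))) (sym (S.iter-%period y (suc j)))))
               (∈-applyUpTo⁺ (λ j → P.iter j x , S.iter j y) (m%n<n (suc j) (P.period x)))

    private
      unique₁ : Unique (map proj₁ graph)
      unique₁ = subst Unique (sym proj₁-graph) (P.Transversal.unique trP)

      unique₂ : Unique (map proj₂ graph)
      unique₂ = subst Unique (sym proj₂-graph) (S.Transversal.unique trS)

      image : ∀ a → ∃[ b ] (a , b) ∈ graph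
      image a with (a′ , b) , ab∈ , refl ← ∈-map⁻ proj₁ (subst (a ∈_) (sym proj₁-graph) (P.Transversal.covers trP a))
        = b , ab∈

      preimage : ∀ b → ∃[ a ] (a , b) ∈ graph
      preimage b with (a , b′) , ab∈ , refl ← ∈-map⁻ proj₂ (subst (b ∈_) (sym proj₂-graph) (S.Transversal.covers trS b))
        = a , ab∈

      functional : ∀ {a b b′} → (a , b) ∈ graph → (a , b′) ∈ graph → b ≡ b′
      functional ab∈ ab′∈ = cong proj₂ (unique-key proj₁ unique₁ ab∈ ab′∈ refl)

      injective : ∀ {a a′ b} → (a , b) ∈ graph → (a′ , b) ∈ graph → a ≡ a′
      injective ab∈ a′b∈ = cong proj₁ (unique-key proj₂ unique₂ ab∈ a′b∈ refl)

    τ : Permutation′ n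
    τ = permutation (proj₁ ∘ image) (proj₁ ∘ preimage)
          (λ b → functional (proj₂ (image (proj₁ (preimage b)))) (proj₂ (preimage b)))
          (λ a → injective (proj₂ (preimage (proj₁ (image a)))) (proj₂ (image a)))

    conjugate : Conjugate π σ
    conjugate = τ , λ b → functional (graph-closed (proj₂ (preimage b))) (proj₂ (image (π ⟨$⟩ʳ proj₁ (preimage b))))

  sameCycleType⇒conjugate : ∀ {D E} → P.Transversal D → S.Transversal E → map P.period D ↭ map S.period E → Conjugate π σ
  sameCycleType⇒conjugate {D} {E} trD trE same
    with W , proj₁≡ , proj₂↭ , sameLength ← ↭-map-pairing P.period S.period D E same =
    conjugate W (subst P.Transversal (sym proj₁≡) trD) (S.transversal-resp-↭ (↭-sym proj₂↭) trE) sameLength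

theorem3p14 : ∀ {c ℓ : Level} (K : CommutativeRing c ℓ) → IsField K → CharZero K →
    (n : ℕ) → n ≥ 1 → (π σ : Permutation′ n) →
    Matrices.Similar K n (Matrices.T K n π) (Matrices.T K n σ) →
    Conjugate π σ
theorem3p14 K _ charZero n _ π σ similar =
  Conjugacy.sameCycleType⇒conjugate π σ (proj₂ (Cycles.transversal π)) (proj₂ (Cycles.transversal σ))
    (fixedOddCounts-determine-cycleType π σ (similar⇒fixedOddCount-^ₚ K charZero similar))
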